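{- Let $d\ge1$, $n>d$, and let $\gamma=(\gamma_1,\dots,\gamma_l)$, $l\ge1$, be a partition of a nonnegative integer with $\gamma\neq(0)$ (all $\gamma_i$ positive). Then $$\lambda_{n,d}(\gamma)=\frac{1}{\prod_{k=1}^d m_k(\gamma)!}\sum_{\nu\in N(n,d;\gamma)}\frac{n!}{\nu(I_1)!\,\nu(I_2)!\cdots\nu(I_{2^l})!} =\frac{1}{\prod_{k=1}^d m_k(\gamma)!}\sum_{\nu\in N(n,d;\gamma)}\frac{(\nu(I_2)+\cdots+\nu(I_{2^l}))!}{\nu(I_2)!\cdots\nu(I_{2^l})!}\binom{n}{\nu(I_2)+\cdots+\nu(I_{2^l})}.$$
   Context: For a finite set $X$ put $\operatorname{codim}_d(X)=d+1-|X|$. For a finite collection $\{T_1,\dots,T_l\}$ of pairwise distinct finite sets put $\rho_d(\{T_1,\dots,T_l\})=\sum_{i=1}^l\operatorname{codim}_d(T_i)$ (with $\rho_d(\emptyset)=0$) and $D_d(\{T_1,\dots,T_l\})=\operatorname{codim}_d(T_1\cap\cdots\cap T_l)-\rho_d(\{T_1,\dots,T_l\})$. For integers $d\ge1$, $n>d$, let $L(n,d)$ be the set of all $T\subset 2^{\{1,\dots,n\}}$ such that (1) $D_d(T')>0$ for every $T'\subset T$ with $|T'|>1$, and (2) $0\le |T_i|\le d$ for every $T_i\in T$. For $T=\{T_1,\dots,T_l\}\in L(n,d)$ ordered so that $|T_1|\le\cdots\le|T_l|$, its type is the partition $\gamma_d(T)=(\operatorname{codim}_d(T_1),\dots,\operatorname{codim}_d(T_l))$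 of $\rho_d(T)$ (the type of $\emptyset$ is $(0)$). Let $\lambda_{n,d}(\gamma)=|\{T\in L(n,d):\gamma_d(T)=\gamma\}|$. For a partition $\gamma$, $m_k(\gamma)=|\{i:\gamma_i=k\}|$. Enumerate the subsets of $\{1,\dots,l\}$ as $I_1,\dots,I_{2^l}$ with $I_1=\emptyset$. $N(n,d;\gamma)$ is the set of maps $\nu:2^{\{1,\dots,l\}}\to\mathbb{Z}_{\ge0}$ such that: (a) $\sum_{I:\,i\in I}\nu(I)=d+1-\gamma_i$ for all $i=1,\dots,l$; (b) $\sum_{I':\,I\subset I'}\nu(I')<d+1-\sum_{i\in I}\gamma_i$ for every $I\subset\{1,\dots,l\}$ with $|I|\ge2$; (c) $\sum_{I\subset\{1,\dots,l\}}\nu(I)=n$. -}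

module Defs where

open import Data.Bool using (Bool; true; false; _∧_; if_then_else_)
open import Data.Nat as ℕ using (ℕ; zero; suc; _!; NonZero)
open import Data.Nat.Properties using (≤-decTotalOrder; _!≢0; m*n≢0)
open import Data.Nat.Combinatorics using (_C_)
open import Data.Nat.DivMod using (_/_)
open import Data.Integer as ℤ using (ℤ; +_)
open import Data.Integer.Properties as ℤP using ()
open import Data.Fin using (Fin)
open import Data.Fin.Subset using (Subset; ⋂; ∣_∣; _∈_; _⊆_; outside; inside)
open import Data.Fin.Subset.Properties using (_∈?_; _⊆?_)
open import Data.Vec using (Vec; []; _∷_; toList; lookup)
open import Data.Vec.Properties using (≡-dec)
open import Data.Nat.ListAction using (sum; product)
open import Data.Bool.ListAction using (all)
open import Data.List using (List; []; _∷_; map; concatMap; length;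
                             upTo; allFin; filterᵇ; reverse)
import Data.Bool.Properties as BoolP
open import Data.List.Sort.InsertionSort ≤-decTotalOrder using (sort)
open import Relation.Nullary.Decidable using (⌊_⌋)
open import Data.List.Relation.Binary.Equality.DecPropositional ℕ._≟_ using (_≡?_)

sublists : ∀ {A : Set} → List A → List (List A)
sublists []       = [] ∷ []
sublists (x ∷ xs) = let r = sublists xs in r Data.List.++ map (x ∷_) r

allSubsets : ∀ n → List (Subset n)
allSubsets zero    = [] ∷ []
allSubsets (suc n) = let r = allSubsets n in
  map (outside ∷_) r Data.List.++ map (inside ∷_) r

eqSub : ∀ {n} → Subset n → Subset n → Bool
eqSub I J = ⌊ ≡-dec BoolP._≟_ I J ⌋

codim : ∀ {n} → ℕ → Subset n → ℤ
codim d X = + (suc d) ℤ.- + ∣ X ∣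

ρ : ∀ {n} → ℕ → List (Subset n) → ℤ
ρ d []       = + 0
ρ d (X ∷ Xs) = codim d X ℤ.+ ρ d Xs

D : ∀ {n} → ℕ → List (Subset n) → ℤ
D d T = codim d (⋂ T) ℤ.- ρ d T

-- L(n,d): a collection T ⊂ 2^{1..n} is represented as a list of
-- pairwise distinct subsets (elements of `sublists (allSubsets n)`).

-- condition (1): D_d(T') > 0 for all T' ⊂ T with |T'| > 1
-- condition (2): 0 ≤ |T_i| ≤ d for all T_i ∈ T
inLᵇ : ∀ {n} → ℕ → List (Subset n) → Bool
inLᵇ d T =
  all (λ T' → if ⌊ 1 ℕ.<? length T' ⌋ then ⌊ + 0 ℤ.<? D d T' ⌋ else true) (sublists T)
  ∧ all (λ X → ⌊ ∣ X ∣ ℕ.≤? d ⌋) T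

-- the type γ_d(T): codims listed with |T_1| ≤ ... ≤ |T_l|, i.e. codims
-- in non-increasing order; type of ∅ is (0).
codimℕ : ∀ {n} → ℕ → Subset n → ℕ
codimℕ d X = suc d ℕ.∸ ∣ X ∣   -- agrees with codim on T ∈ L(n,d)

typeOf : ∀ {n} → ℕ → List (Subset n) → List ℕ
typeOf d []         = 0 ∷ []
typeOf d T@(_ ∷ _)  = reverse (sort (map (codimℕ d) T))

lam : ℕ → ℕ → List ℕ → ℕ
lam n d γ = length (filterᵇ (λ T → inLᵇ d T ∧ ⌊ typeOf d T ≡? γ ⌋)
                            (sublists (allSubsets n)))

mult : ∀ {l} → Vec ℕ l → ℕ → ℕ
mult γ k = length (filterᵇ (λ x → ⌊ x ℕ.≟ k ⌋) (toList γ))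

prodMultFact : ∀ {l} → ℕ → Vec ℕ l → ℕ
prodMultFact d γ = product (map (λ k → mult γ k !) (map suc (upTo d)))

-- N(n,d;γ): maps ν : 2^{1..l} → ℕ.  By (c) every value is ≤ n, so we
-- enumerate all maps Subset l → {0..n}, each exactly once.

update : ∀ {l} → (Subset l → ℕ) → Subset l → ℕ → (Subset l → ℕ)
update f I k J = if eqSub J I then k else f J

mapsOn : ∀ {l} → List (Subset l) → ℕ → List (Subset l → ℕ)
mapsOn []       n = (λ _ → 0) ∷ []
mapsOn (I ∷ Is) n = concatMap (λ f → map (update f I) (upTo (suc n))) (mapsOn Is n)

allMaps : (l n : ℕ) → List (Subset l → ℕ)
allMaps l n = mapsOn (allSubsets l) n

sumOver : ∀ {l} → (Subset l → Bool) → (Subset l → ℕ) → ℕ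
sumOver {l} p ν = sum (map ν (filterᵇ p (allSubsets l)))

inNᵇ : ∀ {l} → ℕ → ℕ → Vec ℕ l → (Subset l → ℕ) → Bool
inNᵇ {l} n d γ ν =
  -- (a)
  all (λ i → ⌊ + sumOver (λ I → ⌊ i ∈? I ⌋) ν ℤ.≟ + (suc d) ℤ.- + lookup γ i ⌋)
      (allFin l)
  -- (b)
  ∧ all (λ I → if ⌊ 2 ℕ.≤? ∣ I ∣ ⌋
               then ⌊ + sumOver (λ I' → ⌊ I ⊆? I' ⌋) ν
                        ℤ.<? + (suc d) ℤ.- + sum (map (lookup γ) (filterᵇ (λ i → ⌊ i ∈? I ⌋) (allFin l))) ⌋
               else true)
        (allSubsets l)
  -- (c)
  ∧ ⌊ sumOver (λ _ → true) ν ℕ.≟ n ⌋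

N : ∀ {l} → ℕ → ℕ → Vec ℕ l → List (Subset l → ℕ)
N {l} n d γ = filterᵇ (inNᵇ n d γ) (allMaps l n)

prodFact : List ℕ → ℕ
prodFact xs = product (map _! xs)

prodFact≢0 : ∀ xs → NonZero (prodFact xs)
prodFact≢0 []       = _
prodFact≢0 (x ∷ xs) = m*n≢0 (x !) (prodFact xs) {{x !≢0}} {{prodFact≢0 xs}}

multinomialTerm : ∀ {l} → ℕ → (Subset l → ℕ) → ℕ
multinomialTerm {l} n ν =
  let vs = map ν (allSubsets l) in (n ! / prodFact vs) {{prodFact≢0 vs}}

nonEmpty : ∀ {l} → Subset l → Bool
nonEmpty I = ⌊ 1 ℕ.≤? ∣ I ∣ ⌋

secondTerm : ∀ {l} → ℕ → (Subset l → ℕ) → ℕ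
secondTerm {l} n ν =
  let vs = map ν (filterᵇ nonEmpty (allSubsets l))
      s  = sum vs
  in (s ! / prodFact vs) {{prodFact≢0 vs}} ℕ.* (n C s)

module Submission where

-- The proof is a double count of the words w = (w₁,…,w_n) of subsets of
-- {1..l}, equivalently (by transposing the 0/1-matrix) of the l-tuples
-- T = (T₁,…,T_l) of subsets of {1..n}, with T_i = {j : i ∈ w_j}.
-- * Right-hand side.  The multinomial coefficient n!/∏ν(I)! counts the words
--   whose profile I ↦ #{j : w_j = I} is ν (Multinomial); the second summand
--   equals the first by C(n,s) = n!/(s!(n−s)!).  So the sum over N(n,d;γ)
--   counts the words whose profile lies in N(n,d;γ) (Profiles).
-- * Conversion.  Under transposition, ∑_{I ∋ i} ν(I) = |T_i| and
--   ∑_{I' ⊇ I} ν(I') = |⋂_{i∈I} T_i|, so conditions (a)–(c) on the profile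
--   say exactly that codim(T_i) = γ_i and that T satisfies condition (1) of
--   L(n,d) (Conversion).
-- * Left-hand side.  Grouping the tuples T by their collection of entries C:
--   such a T has no repeated entries (a repeated set violates (1)), so C ∈
--   L(n,d) has type γ, and each such C is listed by exactly ∏_k m_k(γ)!
--   tuples, the sets of each codimension k being permuted freely
--   (LabelledListings, Collections).

open import Data.Bool using (Bool; true; false; _∧_; not; if_then_else_)
import Data.Bool.Properties as Bool
open import Data.Bool.ListAction using (all; and)
open import Data.Nat using (ℕ; zero; suc; _+_; _*_; _∸_; _!; _≤_; _<_; z≤n; s≤s; NonZero)
import Data.Nat as ℕ
open import Data.Nat.Properties using (+-assoc; +-identityʳ; +-suc; +-mono-≤; *-assoc; *-comm;
  *-identityʳ; *-zeroʳ; *-distribˡ-+; m+n≡0⇒m≡0; m+n≡0⇒n≡0; *-cancelʳ-≡; +-cancelʳ-≡; _!≢0; _!*_!≢0;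
  m+n∸n≡m; m≤n+m; m≤n⇒m≤1+n; ≤-refl; ≤-trans; ≤-reflexive; <⇒≤; <⇒≱; ≰⇒>; <-irrefl; ≤∧≢⇒<; m∸n≤m;
  m∸[m∸n]≡n; m≤n⇒m∸n≡0; m>n⇒m∸n≢0; +-∸-assoc; suc-injective; ≤-decTotalOrder; module ≤-Reasoning)
import Data.Nat.Tactic.RingSolver as ℕ-Solver
open import Data.Nat.ListAction using (sum; product)
open import Data.Nat.ListAction.Properties using (sum-++; product-++)
open import Data.Nat.DivMod using (_/_; m*n/n≡m; m/n*n≡m; /-congˡ)
open import Data.Nat.Combinatorics using (k![n∸k]!∣n!) renaming (_C_ to _choose_)
open import Data.Nat.Combinatorics.Specification using (nCk≡n!/k![n-k]!)
open import Data.Integer as ℤ using (ℤ; +_; -[1+_])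
import Data.Integer.Properties as ℤ
import Data.Integer.Tactic.RingSolver as ℤ-Solver
open import Data.List using (List; []; _∷_; _++_; map; concatMap; filterᵇ; length; upTo; allFin; reverse)
import Data.List as List
import Data.List.Properties as Listₚ
open Listₚ using (map-++; ++-identityʳ; map-∘; filter-++)
open import Data.List.Membership.Propositional using (_∈_; _∉_)
open import Data.List.Membership.Propositional.Properties using (∈-map⁺; ∈-map⁻; ∈-++⁺ˡ; ∈-++⁺ʳ; ∈-++⁻;
  ∈-concatMap⁺; ∈-concatMap⁻; ∈-upTo⁺; ∈-upTo⁻; ∈-allFin; ∈-∃++)
open import Data.List.Relation.Unary.Any as Any using (here; there)
import Data.List.Relation.Unary.All as All
open All using (All; []; _∷_)
open import Data.List.Relation.Unary.AllPairs using (AllPairs; []; _∷_)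
import Data.List.Relation.Unary.AllPairs.Properties as AllPairs
open import Data.List.Relation.Unary.Unique.Propositional using (Unique)
import Data.List.Relation.Unary.Unique.Propositional.Properties as Uniqueₚ
open Uniqueₚ using (Unique[x∷xs]⇒x∉xs)
import Data.List.Relation.Binary.Permutation.Propositional as ↭
open ↭ using (_↭_; prep; swap; ↭-refl; ↭-sym; ↭-trans; ↭-reflexive; ↭⇒↭ₛ)
import Data.List.Relation.Binary.Permutation.Propositional.Properties as ↭ₚ
open ↭ₚ using (shift; ∈-resp-↭; ↭-length)
import Data.List.Relation.Binary.Permutation.Setoid.Properties as PermSetoid
open import Data.List.Relation.Binary.Pointwise using (Pointwise-≡⇒≡)
open import Data.List.Relation.Binary.Equality.DecPropositional ℕ._≟_ using (_≡?_)
open import Data.List.Sort.InsertionSort ≤-decTotalOrder using (sort)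
open import Data.List.Sort.InsertionSort.Properties ≤-decTotalOrder using (sort-↭; sort-↗)
open import Data.List.Relation.Unary.Sorted.TotalOrder using (Sorted)
open import Data.List.Relation.Unary.Sorted.TotalOrder.Properties using (↗↭↗⇒≋; AllPairs⇒Sorted)
open import Data.Vec using (Vec; []; _∷_; lookup; tabulate; toList)
import Data.Vec as Vec
open import Data.Vec.Properties using (≡-dec; ∷-injectiveʳ; length-toList; lookup∘tabulate; tabulate∘lookup;
  tabulate-cong; lookup-map; lookup-zipWith; lookup-replicate)
import Data.Vec.Properties as Vec
open import Data.Fin using (Fin; zero; suc; toℕ)
open import Data.Fin.Subset using (Subset; outside; inside; ∣_∣; ⋂; _∩_)
import Data.Fin.Subset as Sub
import Data.Fin.Subset.Properties as Sub
open import Data.Fin.Subset.Properties using (_∈?_; _⊆?_)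
open import Data.Product using (_×_; _,_; proj₁; proj₂; ∃-syntax)
open import Data.Sum using (_⊎_; inj₁; inj₂)
open import Data.Empty using (⊥; ⊥-elim)
open import Relation.Nullary using (¬_; Dec; yes; no; does)
open import Relation.Nullary.Decidable using (⌊_⌋; isYes≗does; does-⇔)
open import Relation.Binary.Bundles using (DecTotalOrder)
open import Relation.Binary.Definitions using (DecidableEquality)
open import Relation.Binary.PropositionalEquality
open import Function using (_∘_; _⇔_; mk⇔; Equivalence)
open import Defs

𝟙 : Bool → ℕ
𝟙 true  = 1
𝟙 false = 0

𝟙-∧ : ∀ a b → 𝟙 (a ∧ b) ≡ 𝟙 a * 𝟙 b
𝟙-∧ true  b = sym (+-identityʳ (𝟙 b))
𝟙-∧ false b = refl

∧-intro : ∀ {a b} → a ≡ true → b ≡ true → (a ∧ b) ≡ true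
∧-intro refl refl = refl

∧-true₁ : ∀ {a b} → (a ∧ b) ≡ true → a ≡ true
∧-true₁ {true} _ = refl

∧-true₂ : ∀ {a b} → (a ∧ b) ≡ true → b ≡ true
∧-true₂ {true} e = e

∧-false : ∀ {a b} → a ≡ false → (a ∧ b) ≡ false
∧-false refl = refl

≡true-⇔ : ∀ {a b} → (a ≡ true → b ≡ true) → (b ≡ true → a ≡ true) → a ≡ b
≡true-⇔ {true}  {true}  _ _ = refl
≡true-⇔ {true}  {false} f _ = sym (f refl)
≡true-⇔ {false} {true}  _ g = g refl
≡true-⇔ {false} {false} _ _ = refl

∑ : ∀ {A : Set} → List A → (A → ℕ) → ℕ
∑ xs f = sum (map f xs)

syntax ∑ xs (λ x → e) = ∑[ x ← xs ] e

module _ {A : Set} where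

  ∑-cong : ∀ (xs : List A) {f g : A → ℕ} → (∀ {x} → x ∈ xs → f x ≡ g x) → ∑ xs f ≡ ∑ xs g
  ∑-cong []       e = refl
  ∑-cong (x ∷ xs) e = cong₂ _+_ (e (here refl)) (∑-cong xs (e ∘ there))

  ∑-++ : ∀ (xs ys : List A) f → ∑ (xs ++ ys) f ≡ ∑ xs f + ∑ ys f
  ∑-++ xs ys f = trans (cong sum (map-++ f xs ys)) (sum-++ (map f xs) (map f ys))

  ∑-zero : ∀ (xs : List A) → ∑[ x ← xs ] 0 ≡ 0
  ∑-zero []       = refl
  ∑-zero (x ∷ xs) = ∑-zero xs

  ∑-+ : ∀ (xs : List A) f g → ∑[ x ← xs ] (f x + g x) ≡ ∑ xs f + ∑ xs g
  ∑-+ []       f g = refl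
  ∑-+ (x ∷ xs) f g = trans (cong (λ z → f x + g x + z) (∑-+ xs f g)) (interchange (f x) (g x) (∑ xs f) (∑ xs g))
    where
    interchange : ∀ a b c e → a + b + (c + e) ≡ a + c + (b + e)
    interchange = ℕ-Solver.solve-∀

  ∑-*ˡ : ∀ (xs : List A) c f → ∑[ x ← xs ] (c * f x) ≡ c * ∑ xs f
  ∑-*ˡ []       c f = sym (*-zeroʳ c)
  ∑-*ˡ (x ∷ xs) c f = trans (cong (λ z → c * f x + z) (∑-*ˡ xs c f)) (sym (*-distribˡ-+ c (f x) _))

  ∑-*ʳ : ∀ (xs : List A) c f → ∑[ x ← xs ] (f x * c) ≡ ∑ xs f * c
  ∑-*ʳ xs c f = trans (∑-cong xs (λ {x} _ → *-comm (f x) c)) (trans (∑-*ˡ xs c f) (*-comm c _))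


∑-swap : ∀ {A B : Set} (xs : List A) (ys : List B) (K : A → B → ℕ) →
         ∑[ x ← xs ] ∑ ys (K x) ≡ ∑[ y ← ys ] ∑[ x ← xs ] K x y
∑-swap []       ys K = sym (∑-zero ys)
∑-swap (x ∷ xs) ys K = trans (cong (λ z → ∑ ys (K x) + z) (∑-swap xs ys K))
                             (sym (∑-+ ys (K x) (λ y → ∑[ x ← xs ] K x y)))

module _ {A : Set} where

  ∑-mono : ∀ (xs : List A) {f g : A → ℕ} → (∀ {x} → x ∈ xs → f x ≤ g x) → ∑ xs f ≤ ∑ xs g
  ∑-mono []       _ = z≤n
  ∑-mono (x ∷ xs) f≤g = +-mono-≤ (f≤g (here refl)) (∑-mono xs (f≤g ∘ there))

  ∑-map : ∀ {B : Set} (g : A → B) (xs : List A) f → ∑ (map g xs) f ≡ ∑ xs (f ∘ g)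
  ∑-map g []       f = refl
  ∑-map g (x ∷ xs) f = cong (λ z → f (g x) + z) (∑-map g xs f)

  ∑-concatMap : ∀ {B : Set} (g : A → List B) (xs : List A) f →
                ∑ (concatMap g xs) f ≡ ∑[ x ← xs ] ∑ (g x) f
  ∑-concatMap g []       f = refl
  ∑-concatMap g (x ∷ xs) f = trans (∑-++ (g x) (concatMap g xs) f) (cong (λ z → ∑ (g x) f + z) (∑-concatMap g xs f))

  ∑-filterᵇ : ∀ (p : A → Bool) (xs : List A) f → ∑ (filterᵇ p xs) f ≡ ∑[ x ← xs ] (𝟙 (p x) * f x)
  ∑-filterᵇ p []       f = refl
  ∑-filterᵇ p (x ∷ xs) f with p x
  ... | true  = cong₂ _+_ (sym (+-identityʳ (f x))) (∑-filterᵇ p xs f)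
  ... | false = ∑-filterᵇ p xs f

  length-filterᵇ : ∀ (p : A → Bool) (xs : List A) → length (filterᵇ p xs) ≡ ∑[ x ← xs ] 𝟙 (p x)
  length-filterᵇ p []       = refl
  length-filterᵇ p (x ∷ xs) with p x
  ... | true  = cong suc (length-filterᵇ p xs)
  ... | false = length-filterᵇ p xs

  ∑-fibres : ∀ {B : Set} (R : A → B → Bool) (xs : List A) (ys : List B) (F : A → ℕ) →
             (∀ {x} → x ∈ xs → ∑[ y ← ys ] 𝟙 (R x y) ≡ 1) →
             ∑ xs F ≡ ∑[ y ← ys ] ∑[ x ← xs ] (𝟙 (R x y) * F x)
  ∑-fibres R xs ys F once = sym (begin
    ∑[ y ← ys ] ∑[ x ← xs ] (𝟙 (R x y) * F x) ≡⟨ ∑-swap ys xs (λ y x → 𝟙 (R x y) * F x) ⟩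
    ∑[ x ← xs ] ∑[ y ← ys ] (𝟙 (R x y) * F x) ≡⟨ ∑-cong xs (λ {x} x∈ → trans (∑-*ʳ ys (F x) (λ y → 𝟙 (R x y)))
                                                                 (trans (cong (_* F x) (once x∈)) (+-identityʳ (F x)))) ⟩
    ∑ xs F                                     ∎)
    where open ≡-Reasoning

record Enumerates {A : Set} (xs : List A) : Set where
  field
    unique   : Unique xs
    complete : ∀ a → a ∈ xs

module Occurrences {A : Set} (_≟_ : DecidableEquality A) where

  infix 4 _==_
  _==_ : A → A → Bool
  a == b = ⌊ a ≟ b ⌋

  ==-refl : ∀ a → (a == a) ≡ true
  ==-refl a with a ≟ a
  ... | yes _ = refl
  ... | no ¬p = ⊥-elim (¬p refl)

  ==-true : ∀ {a b} → (a == b) ≡ true → a ≡ b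
  ==-true {a} {b} e with a ≟ b
  ... | yes p = p

  ==-false : ∀ {a b} → ¬ a ≡ b → (a == b) ≡ false
  ==-false {a} {b} ne with a ≟ b
  ... | yes p = ⊥-elim (ne p)
  ... | no _  = refl

  ==-sym : ∀ a b → (a == b) ≡ (b == a)
  ==-sym a b with a ≟ b | b ≟ a
  ... | yes _ | yes _ = refl
  ... | no _  | no _  = refl
  ... | yes p | no q  = ⊥-elim (q (sym p))
  ... | no p  | yes q = ⊥-elim (p (sym q))

  count : A → List A → ℕ
  count a xs = ∑[ y ← xs ] 𝟙 (a == y)

  count-∉ : ∀ {a} xs → a ∉ xs → count a xs ≡ 0
  count-∉     []       _  = refl
  count-∉ {a} (x ∷ xs) a∉ with a ≟ x
  ... | yes refl = ⊥-elim (a∉ (here refl))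
  ... | no _     = count-∉ xs (a∉ ∘ there)

  count-unique : ∀ {a xs} → Unique xs → a ∈ xs → count a xs ≡ 1
  count-unique {a} {x ∷ xs} u@(_ ∷ _) (here refl) rewrite ==-refl a = cong suc (count-∉ xs (Unique[x∷xs]⇒x∉xs u))
  count-unique {a} {x ∷ xs} u@(_ ∷ u′) (there a∈) with a ≟ x
  ... | yes refl = ⊥-elim (Unique[x∷xs]⇒x∉xs u a∈)
  ... | no _     = count-unique u′ a∈

  count≤length : ∀ a xs → count a xs ≤ length xs
  count≤length a []       = z≤n
  count≤length a (x ∷ xs) with a == x
  ... | true  = s≤s (count≤length a xs)
  ... | false = m≤n⇒m≤1+n (count≤length a xs)

  ∑-pick : ∀ {xs} → Enumerates xs → ∀ (f : A → ℕ) a → ∑[ y ← xs ] (𝟙 (a == y) * f y) ≡ f a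
  ∑-pick {xs} en f a = begin
    ∑[ y ← xs ] (𝟙 (a == y) * f y) ≡⟨ ∑-cong xs (λ {y} _ → atDiagonal y) ⟩
    ∑[ y ← xs ] (𝟙 (a == y) * f a) ≡⟨ ∑-*ʳ xs (f a) (λ y → 𝟙 (a == y)) ⟩
    count a xs * f a               ≡⟨ cong (_* f a) (count-unique (Enumerates.unique en) (Enumerates.complete en a)) ⟩
    1 * f a                        ≡⟨ +-identityʳ (f a) ⟩
    f a                            ∎
    where
    open ≡-Reasoning
    atDiagonal : ∀ y → 𝟙 (a == y) * f y ≡ 𝟙 (a == y) * f a
    atDiagonal y with a ≟ y
    ... | yes refl = refl
    ... | no _     = refl

∑-bijection : ∀ {A B : Set} (_≟ᴬ_ : DecidableEquality A) (_≟ᴮ_ : DecidableEquality B) {xs ys} →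
              Enumerates xs → Enumerates ys → (f : A → B) (g : B → A) →
              (∀ x → g (f x) ≡ x) → (∀ y → f (g y) ≡ y) → (F : B → ℕ) → ∑ xs (F ∘ f) ≡ ∑ ys F
∑-bijection _≟ᴬ_ _≟ᴮ_ {xs} {ys} enA enB f g gf fg F = begin
  ∑ xs (F ∘ f)
    ≡⟨ ∑-fibres (λ x y → f x B.== y) xs ys (F ∘ f)
                (λ {x} _ → B.count-unique (Enumerates.unique enB) (Enumerates.complete enB (f x))) ⟩
  ∑[ y ← ys ] ∑[ x ← xs ] (𝟙 (f x B.== y) * F (f x))
    ≡⟨ ∑-cong ys (λ {y} _ → ∑-cong xs (λ {x} _ → fibreOf y x)) ⟩
  ∑[ y ← ys ] ∑[ x ← xs ] (𝟙 (g y A.== x) * F y)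
    ≡⟨ ∑-cong ys (λ {y} _ → A.∑-pick enA (λ _ → F y) (g y)) ⟩
  ∑ ys F ∎
  where
  open ≡-Reasoning
  module A = Occurrences _≟ᴬ_
  module B = Occurrences _≟ᴮ_
  -- f x = y exactly when x = g y
  fibreOf : ∀ y x → 𝟙 (f x B.== y) * F (f x) ≡ 𝟙 (g y A.== x) * F y
  fibreOf y x with f x ≟ᴮ y | g y ≟ᴬ x
  ... | yes refl | yes _   = refl
  ... | yes refl | no g≢x  = ⊥-elim (g≢x (gf x))
  ... | no  f≢y  | yes refl = ⊥-elim (f≢y (fg y))
  ... | no  _    | no _    = refl

words : ∀ {A : Set} → List A → (k : ℕ) → List (Vec A k)
words U zero    = [] ∷ []
words U (suc k) = concatMap (λ a → map (a ∷_) (words U k)) U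

module _ {A : Set} (U : List A) where

  words-complete : (∀ a → a ∈ U) → ∀ k (w : Vec A k) → w ∈ words U k
  words-complete U-complete zero    []      = here refl
  words-complete U-complete (suc k) (a ∷ w) =
    ∈-concatMap⁺ (λ b → map (b ∷_) (words U k))
      (Any.map (λ { refl → ∈-map⁺ (a ∷_) (words-complete U-complete k w) }) (U-complete a))

  head∈ : ∀ {k} (V : List A) {w : Vec A (suc k)} → w ∈ concatMap (λ b → map (b ∷_) (words U k)) V → Vec.head w ∈ V
  head∈ V w∈ = Any.map (λ p → let _ , _ , e = ∈-map⁻ _ p in cong Vec.head e) (∈-concatMap⁻ _ {xs = V} w∈)

  words-unique : Unique U → ∀ k → Unique (words U k)
  words-unique U-unique zero    = All.[] ∷ []
  words-unique U-unique (suc k) = blocks U-unique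
    where
    blocks : ∀ {V} → Unique V → Unique (concatMap (λ b → map (b ∷_) (words U k)) V)
    blocks {[]}    []           = []
    blocks {a ∷ V} u@(_ ∷ uV) =
      Uniqueₚ.++⁺ (Uniqueₚ.map⁺ ∷-injectiveʳ (words-unique U-unique k)) (blocks uV)
        λ (p , q) → let _ , _ , e = ∈-map⁻ _ p in
                    Unique[x∷xs]⇒x∉xs u (subst (_∈ V) (cong Vec.head e) (head∈ V q))

allSubsets≡words : ∀ n → allSubsets n ≡ words (false ∷ true ∷ []) n
allSubsets≡words zero    = refl
allSubsets≡words (suc n) rewrite allSubsets≡words n =
  cong (map (outside ∷_) W ++_) (sym (++-identityʳ (map (inside ∷_) W)))
  where W = words (false ∷ true ∷ []) n

allSubsets-complete : ∀ n (X : Subset n) → X ∈ allSubsets n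
allSubsets-complete n X = subst (X ∈_) (sym (allSubsets≡words n))
  (words-complete _ (λ { false → here refl ; true → there (here refl) }) n X)

allSubsets-unique : ∀ n → Unique (allSubsets n)
allSubsets-unique n = subst Unique (sym (allSubsets≡words n))
  (words-unique _ (((λ ()) All.∷ All.[]) ∷ All.[] ∷ []) n)

module _ {A : Set} where

  skip : ∀ (x : A) xs {Z} → Z ∈ sublists xs → Z ∈ sublists (x ∷ xs)
  skip x xs = ∈-++⁺ˡ

  keep : ∀ (x : A) xs {Z} → Z ∈ sublists xs → (x ∷ Z) ∈ sublists (x ∷ xs)
  keep x xs p = ∈-++⁺ʳ (sublists xs) (∈-map⁺ (x ∷_) p)

  sublists-∷⁻ : ∀ {x : A} {xs Z} → Z ∈ sublists (x ∷ xs) →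
                Z ∈ sublists xs ⊎ ∃[ Z′ ] (Z ≡ x ∷ Z′ × Z′ ∈ sublists xs)
  sublists-∷⁻ {x} {xs} p with ∈-++⁻ (sublists xs) p
  ... | inj₁ q = inj₁ q
  ... | inj₂ q = let Z′ , q′ , e = ∈-map⁻ (x ∷_) q in inj₂ (Z′ , e , q′)

  sublist-⊆ : ∀ {xs Z} → Z ∈ sublists xs → ∀ {a : A} → a ∈ Z → a ∈ xs
  sublist-⊆ {[]}     (here refl) ()
  sublist-⊆ {x ∷ xs} p a∈ with sublists-∷⁻ {x = x} {xs} p
  ... | inj₁ q                       = there (sublist-⊆ q a∈)
  ... | inj₂ (_ , refl , q) with a∈
  ...   | here refl = here refl
  ...   | there a∈′ = there (sublist-⊆ q a∈′)

  singleton-sublist : ∀ {xs} {a : A} → a ∈ xs → (a ∷ []) ∈ sublists xs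
  singleton-sublist {x ∷ xs} (here refl) = keep x xs (empty-sublist xs)
    where
    empty-sublist : ∀ ys → [] ∈ sublists ys
    empty-sublist []       = here refl
    empty-sublist (y ∷ ys) = skip y ys (empty-sublist ys)
  singleton-sublist {x ∷ xs} (there a∈) = skip x xs (singleton-sublist a∈)

  filterᵇ-sublist : ∀ (p : A → Bool) xs → filterᵇ p xs ∈ sublists xs
  filterᵇ-sublist p []       = here refl
  filterᵇ-sublist p (x ∷ xs) with p x
  ... | true  = keep x xs (filterᵇ-sublist p xs)
  ... | false = skip x xs (filterᵇ-sublist p xs)

  sublist-unique : ∀ {xs Z} → Unique xs → Z ∈ sublists xs → Unique Z
  sublist-unique {[]}     []         (here refl) = []
  sublist-unique {x ∷ xs} u@(_ ∷ u′) p with sublists-∷⁻ {x = x} {xs} p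
  ... | inj₁ q              = sublist-unique u′ q
  ... | inj₂ (_ , refl , q) =
    All.tabulate (λ a∈ x≡a → Unique[x∷xs]⇒x∉xs u (subst (_∈ xs) (sym x≡a) (sublist-⊆ q a∈)))
    ∷ sublist-unique u′ q

  sublists-unique : ∀ {xs : List A} → Unique xs → Unique (sublists xs)
  sublists-unique {[]}     []         = All.[] ∷ []
  sublists-unique {x ∷ xs} u@(_ ∷ u′) =
    Uniqueₚ.++⁺ (sublists-unique u′) (Uniqueₚ.map⁺ (λ { refl → refl }) (sublists-unique u′))
      λ (p , q) → let _ , _ , e = ∈-map⁻ (x ∷_) q in
                  Unique[x∷xs]⇒x∉xs u (sublist-⊆ p (subst (x ∈_) (sym e) (here refl)))

  sublists-↭ : ∀ {xs ys : List A} → xs ↭ ys → ∀ {Z} → Z ∈ sublists xs → ∃[ W ] (W ∈ sublists ys × Z ↭ W)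
  sublists-↭ ↭.refl {Z} p = Z , p , ↭-refl
  sublists-↭ (prep {xs = xs} {ys = ys} x q) p with sublists-∷⁻ {x = x} {xs} p
  ... | inj₁ r              = let W , s , t = sublists-↭ q r in W , skip x ys s , t
  ... | inj₂ (_ , refl , r) = let W , s , t = sublists-↭ q r in x ∷ W , keep x ys s , prep x t
  sublists-↭ (swap {xs = xs} {ys = ys} x y q) p with sublists-∷⁻ {x = x} {y ∷ xs} p
  ... | inj₁ r with sublists-∷⁻ {x = y} {xs} r
  ...   | inj₁ r′              = let W , s , t = sublists-↭ q r′ in W , skip y (x ∷ ys) (skip x ys s) , t
  ...   | inj₂ (_ , refl , r′) = let W , s , t = sublists-↭ q r′ in y ∷ W , keep y (x ∷ ys) (skip x ys s) , prep y t
  sublists-↭ (swap {xs = xs} {ys = ys} x y q) p | inj₂ (_ , refl , r) with sublists-∷⁻ {x = y} {xs} r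
  ...   | inj₁ r′              = let W , s , t = sublists-↭ q r′ in x ∷ W , skip y (x ∷ ys) (keep x ys s) , prep x t
  ...   | inj₂ (_ , refl , r′) = let W , s , t = sublists-↭ q r′ in y ∷ x ∷ W , keep y (x ∷ ys) (keep x ys s) , swap x y t
  sublists-↭ (↭.trans q₁ q₂) p =
    let W , s , t = sublists-↭ q₁ p ; W′ , s′ , t′ = sublists-↭ q₂ s in W′ , s′ , ↭-trans t t′

  filterᵇ-cong : ∀ {p q : A → Bool} xs → (∀ {x} → x ∈ xs → p x ≡ q x) → filterᵇ p xs ≡ filterᵇ q xs
  filterᵇ-cong             []       e = refl
  filterᵇ-cong {p} {q} (x ∷ xs) e with p x | q x | e (here refl)
  ... | true  | .true  | refl = cong (x ∷_) (filterᵇ-cong xs (e ∘ there))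
  ... | false | .false | refl = filterᵇ-cong xs (e ∘ there)

  ∈-filterᵇ⁺ : ∀ (p : A → Bool) {xs x} → x ∈ xs → p x ≡ true → x ∈ filterᵇ p xs
  ∈-filterᵇ⁺ p {y ∷ xs} (here refl) px rewrite px = here refl
  ∈-filterᵇ⁺ p {y ∷ xs} (there x∈) px with p y
  ... | true  = there (∈-filterᵇ⁺ p x∈ px)
  ... | false = ∈-filterᵇ⁺ p x∈ px

  ∈-filterᵇ⁻ : ∀ (p : A → Bool) {xs x} → x ∈ filterᵇ p xs → x ∈ xs × p x ≡ true
  ∈-filterᵇ⁻ p {y ∷ xs} x∈ with p y in py
  ... | false = let x∈′ , px = ∈-filterᵇ⁻ p x∈ in there x∈′ , px
  ... | true with x∈
  ...   | here refl = here refl , py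
  ...   | there x∈′ = let x∈″ , px = ∈-filterᵇ⁻ p x∈′ in there x∈″ , px

  filterᵇ-true : ∀ (xs : List A) → filterᵇ (λ _ → true) xs ≡ xs
  filterᵇ-true []       = refl
  filterᵇ-true (x ∷ xs) = cong (x ∷_) (filterᵇ-true xs)

module SubCollections {A : Set} (_≟_ : DecidableEquality A) where
  open import Data.List.Membership.DecPropositional _≟_ using () renaming (_∈?_ to _∈ₗ?_)

  isIn : List A → A → Bool
  isIn C Y = does (Y ∈ₗ? C)

  isIn⇔ : ∀ {C Y} → isIn C Y ≡ true ⇔ Y ∈ C
  isIn⇔ {C} {Y} with Y ∈ₗ? C
  ... | yes Y∈ = mk⇔ (λ _ → Y∈) (λ _ → refl)
  ... | no Y∉  = mk⇔ (λ ()) (λ Y∈ → ⊥-elim (Y∉ Y∈))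

  sublist-as-filter : ∀ {U} → Unique U → ∀ {C} → C ∈ sublists U → C ≡ filterᵇ (isIn C) U
  sublist-as-filter {[]}    []         (here refl) = refl
  sublist-as-filter {x ∷ U} u@(_ ∷ u′) {C} p with sublists-∷⁻ {x = x} {U} p
  ... | inj₁ q with x ∈ₗ? C
  ...   | yes x∈ = ⊥-elim (Unique[x∷xs]⇒x∉xs u (sublist-⊆ q x∈))
  ...   | no _   = sublist-as-filter u′ q
  sublist-as-filter {x ∷ U} u@(_ ∷ u′) p | inj₂ (Z , refl , q) with x ≟ x
  ... | no x≢x = ⊥-elim (x≢x refl)
  ... | yes _  = cong (x ∷_) (trans (sublist-as-filter u′ q) (filterᵇ-cong U λ {Y} Y∈ → sym (dropHead Y∈)))
    where
    dropHead : ∀ {Y} → Y ∈ U → isIn (x ∷ Z) Y ≡ isIn Z Y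
    dropHead {Y} Y∈ with Y ≟ x
    ... | yes refl = ⊥-elim (Unique[x∷xs]⇒x∉xs u Y∈)
    ... | no _     = refl

module ℕOcc = Occurrences ℕ._≟_
open ℕOcc using () renaming (_==_ to _=ℕ_; ==-refl to =ℕ-refl; ==-true to =ℕ-true)

positive : ℕ → Bool
positive zero    = false
positive (suc _) = true

suc=ℕ : ∀ k x → (suc k =ℕ x) ≡ positive x ∧ (k =ℕ x ∸ 1)
suc=ℕ k zero    = refl
suc=ℕ k (suc x) with k ℕ.≟ x
... | yes refl = =ℕ-refl (suc k)
... | no k≢x with suc k ℕ.≟ suc x
...   | yes e = ⊥-elim (k≢x (cong ℕ.pred e))
...   | no _  = refl

module _ {A : Set} where

  all-∧ : ∀ (p q : A → Bool) xs → all (λ b → p b ∧ q b) xs ≡ all p xs ∧ all q xs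
  all-∧ p q []       = refl
  all-∧ p q (x ∷ xs) rewrite all-∧ p q xs with p x | q x | all p xs
  ... | true  | true  | _     = refl
  ... | true  | false | true  = refl
  ... | true  | false | false = refl
  ... | false | _     | _     = refl

  all-true⇒ : ∀ {p : A → Bool} xs → all p xs ≡ true → ∀ {x} → x ∈ xs → p x ≡ true
  all-true⇒ (y ∷ xs) e (here refl) = ∧-true₁ e
  all-true⇒ (y ∷ xs) e (there x∈)  = all-true⇒ xs (∧-true₂ e) x∈

  ⇒all-true : ∀ {p : A → Bool} xs → (∀ {x} → x ∈ xs → p x ≡ true) → all p xs ≡ true
  ⇒all-true []       f = refl
  ⇒all-true (y ∷ xs) f = ∧-intro (f (here refl)) (⇒all-true xs (f ∘ there))

  all-cong : ∀ {p q : A → Bool} xs → (∀ {x} → x ∈ xs → p x ≡ q x) → all p xs ≡ all q xs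
  all-cong []       e = refl
  all-cong (x ∷ xs) e = cong₂ _∧_ (e (here refl)) (all-cong xs (e ∘ there))

module Multinomial {A : Set} (_≟_ : DecidableEquality A) where
  open Occurrences _≟_

  occ : ∀ {k} → A → Vec A k → ℕ
  occ a w = count a (toList w)

  hasProfile : ∀ {k} → List A → Vec A k → (A → ℕ) → Bool
  hasProfile U w ν = all (λ b → occ b w =ℕ ν b) U

  #words : List A → ℕ → (A → ℕ) → ℕ
  #words U n ν = ∑[ w ← words U n ] 𝟙 (hasProfile U w ν)

  _[_≔_] : (A → ℕ) → A → ℕ → (A → ℕ)
  (ν [ a ≔ k ]) b = if b == a then k else ν b

  ≔-self : ∀ ν a k → (ν [ a ≔ k ]) a ≡ k
  ≔-self ν a k rewrite ==-refl a = refl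

  ≔-other : ∀ ν a k {b} → ¬ b ≡ a → (ν [ a ≔ k ]) b ≡ ν b
  ≔-other ν a k ne rewrite ==-false ne = refl

  ≔-outside : ∀ (F : ℕ → ℕ) ν a k U → a ∉ U → map (F ∘ ν [ a ≔ k ]) U ≡ map (F ∘ ν) U
  ≔-outside F ν a k []      a∉ = refl
  ≔-outside F ν a k (b ∷ U) a∉ =
    cong₂ _∷_ (cong F (≔-other ν a k (λ { refl → a∉ (here refl) }))) (≔-outside F ν a k U (a∉ ∘ there))

  ∑-≔ : ∀ ν a k {U} → Unique U → a ∈ U → sum (map (ν [ a ≔ k ]) U) + ν a ≡ sum (map ν U) + k
  ∑-≔ ν a k {b ∷ U} u (here refl) =
    trans (cong₂ (λ x s → x + s + ν a) (≔-self ν a k) (cong sum (≔-outside (λ x → x) ν a k U (Unique[x∷xs]⇒x∉xs u))))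
          (rearrange k (sum (map ν U)) (ν a))
    where
    rearrange : ∀ x y z → x + y + z ≡ z + y + x
    rearrange = ℕ-Solver.solve-∀
  ∑-≔ ν a k {b ∷ U} u@(_ ∷ u′) (there a∈) =
    trans (cong (λ x → x + sum (map (ν [ a ≔ k ]) U) + ν a) (≔-other ν a k (λ { refl → Unique[x∷xs]⇒x∉xs u a∈ })))
          (trans (+-assoc (ν b) _ (ν a)) (trans (cong (λ z → ν b + z) (∑-≔ ν a k u′ a∈)) (sym (+-assoc (ν b) _ k))))

  ∏-≔ : ∀ (F : ℕ → ℕ) ν a k {U} → Unique U → a ∈ U →
        product (map (F ∘ ν [ a ≔ k ]) U) * F (ν a) ≡ product (map (F ∘ ν) U) * F k
  ∏-≔ F ν a k {b ∷ U} u (here refl) =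
    trans (cong₂ (λ x P → F x * P * F (ν a)) (≔-self ν a k) (cong product (≔-outside F ν a k U (Unique[x∷xs]⇒x∉xs u))))
          (rearrange (F k) (product (map (F ∘ ν) U)) (F (ν a)))
    where
    rearrange : ∀ x y z → x * y * z ≡ z * y * x
    rearrange = ℕ-Solver.solve-∀
  ∏-≔ F ν a k {b ∷ U} u@(_ ∷ u′) (there a∈) =
    trans (cong (λ x → x * product (map (F ∘ ν [ a ≔ k ]) U) * F (ν a))
                (cong F (≔-other ν a k (λ { refl → Unique[x∷xs]⇒x∉xs u a∈ }))))
          (trans (*-assoc (F (ν b)) _ _) (trans (cong (F (ν b) *_) (∏-≔ F ν a k u′ a∈)) (sym (*-assoc (F (ν b)) _ _))))

  all-only : ∀ a P U → a ∈ U → all (λ b → if b == a then P else true) U ≡ P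
  all-only a false U a∈ = atA U a∈
    where
    atA : ∀ V → a ∈ V → all (λ b → if b == a then false else true) V ≡ false
    atA (b ∷ V) (here refl) rewrite ==-refl b = refl
    atA (b ∷ V) (there p) with b == a
    ... | true  = refl
    ... | false = atA V p
  all-only a true U _ = everywhere U
    where
    everywhere : ∀ V → all (λ b → if b == a then true else true) V ≡ true
    everywhere []      = refl
    everywhere (b ∷ V) with b == a
    ... | true  = everywhere V
    ... | false = everywhere V

  hasProfile-∷ : ∀ {k} U a (w : Vec A k) ν → a ∈ U →
                 hasProfile U (a ∷ w) ν ≡ positive (ν a) ∧ hasProfile U w (ν [ a ≔ ν a ∸ 1 ])
  hasProfile-∷ U a w ν a∈ = begin
    hasProfile U (a ∷ w) ν
      ≡⟨ all-cong U (λ {b} _ → perLetter b) ⟩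
    all (λ b → (if b == a then positive (ν a) else true) ∧ (occ b w =ℕ (ν [ a ≔ ν a ∸ 1 ]) b)) U
      ≡⟨ all-∧ _ _ U ⟩
    all (λ b → if b == a then positive (ν a) else true) U ∧ hasProfile U w (ν [ a ≔ ν a ∸ 1 ])
      ≡⟨ cong (_∧ hasProfile U w (ν [ a ≔ ν a ∸ 1 ])) (all-only a (positive (ν a)) U a∈) ⟩
    positive (ν a) ∧ hasProfile U w (ν [ a ≔ ν a ∸ 1 ]) ∎
    where
    open ≡-Reasoning
    perLetter : ∀ b → (𝟙 (b == a) + occ b w =ℕ ν b)
                    ≡ (if b == a then positive (ν a) else true) ∧ (occ b w =ℕ (ν [ a ≔ ν a ∸ 1 ]) b)
    perLetter b with b ≟ a
    ... | yes refl = suc=ℕ (occ b w) (ν b)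
    ... | no _     = refl

  #words-suc : ∀ U n ν → #words U (suc n) ν ≡ ∑[ a ← U ] (𝟙 (positive (ν a)) * #words U n (ν [ a ≔ ν a ∸ 1 ]))
  #words-suc U n ν =
    trans (∑-concatMap (λ a → map (a ∷_) (words U n)) U (λ w → 𝟙 (hasProfile U w ν)))
          (∑-cong U λ {a} a∈ →
            trans (∑-map (a ∷_) (words U n) (λ w → 𝟙 (hasProfile U w ν)))
                  (trans (∑-cong (words U n) (λ {w} _ → trans (cong 𝟙 (hasProfile-∷ U a w ν a∈)) (𝟙-∧ (positive (ν a)) _)))
                         (∑-*ˡ (words U n) (𝟙 (positive (ν a))) _)))

  ∏! : List A → (A → ℕ) → ℕ
  ∏! U ν = product (map (λ b → ν b !) U)

  vanishing-profile : ∀ U ν → sum (map ν U) ≡ 0 → hasProfile U [] ν ≡ true × ∏! U ν ≡ 1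
  vanishing-profile []      ν e = refl , refl
  vanishing-profile (b ∷ U) ν e with ν b | m+n≡0⇒m≡0 (ν b) e | m+n≡0⇒n≡0 (ν b) e
  ... | .0 | refl | e′ = let h , p = vanishing-profile U ν e′ in h , trans (+-identityʳ _) p

  multinomial : ∀ {U} → Unique U → ∀ n ν → sum (map ν U) ≡ n → #words U n ν * ∏! U ν ≡ n !
  multinomial {U} u zero ν ∑ν≡0 with vanishing-profile U ν ∑ν≡0
  ... | h , p rewrite h | p = refl
  multinomial {U} u (suc n) ν ∑ν≡n+1 = begin
    #words U (suc n) ν * ∏! U ν
      ≡⟨ cong (_* ∏! U ν) (#words-suc U n ν) ⟩
    ∑[ a ← U ] (𝟙 (positive (ν a)) * #words U n (ν [ a ≔ ν a ∸ 1 ])) * ∏! U ν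
      ≡⟨ ∑-*ʳ U (∏! U ν) _ ⟨
    ∑[ a ← U ] (𝟙 (positive (ν a)) * #words U n (ν [ a ≔ ν a ∸ 1 ]) * ∏! U ν)
      ≡⟨ ∑-cong U removeFirst ⟩
    ∑[ a ← U ] (ν a * n !)
      ≡⟨ ∑-*ʳ U (n !) ν ⟩
    sum (map ν U) * n !
      ≡⟨ cong (_* n !) ∑ν≡n+1 ⟩
    suc n !
      ∎
    where
    open ≡-Reasoning
    -- words starting with a: by induction there are n!/∏ (ν − δ_a)! of them
    removeFirst : ∀ {a} → a ∈ U → 𝟙 (positive (ν a)) * #words U n (ν [ a ≔ ν a ∸ 1 ]) * ∏! U ν ≡ ν a * n !
    removeFirst {a} a∈ with ν a in νa
    ... | zero  = refl
    ... | suc m = begin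
      (#words U n ν′ + 0) * ∏! U ν    ≡⟨ cong (_* ∏! U ν) (+-identityʳ (#words U n ν′)) ⟩
      #words U n ν′ * ∏! U ν          ≡⟨ cong (#words U n ν′ *_) ∏ν ⟩
      #words U n ν′ * (∏! U ν′ * suc m) ≡⟨ *-assoc (#words U n ν′) _ _ ⟨
      #words U n ν′ * ∏! U ν′ * suc m ≡⟨ cong (_* suc m) (multinomial u n ν′ ∑ν′) ⟩
      n ! * suc m                      ≡⟨ *-comm (n !) (suc m) ⟩
      suc m * n !                      ∎
      where
      ν′ = ν [ a ≔ m ]
      ∏ν : ∏! U ν ≡ ∏! U ν′ * suc m
      ∏ν = *-cancelʳ-≡ _ _ (m !) {{m !≢0}}
             (sym (trans (*-assoc (∏! U ν′) (suc m) (m !))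
                         (trans (cong (λ x → ∏! U ν′ * x !) (sym νa)) (∏-≔ _! ν a m u a∈))))
      ∑ν′ : sum (map ν′ U) ≡ n
      ∑ν′ = +-cancelʳ-≡ (suc m) _ n
              (trans (cong (λ z → sum (map ν′ U) + z) (sym νa))
                     (trans (∑-≔ ν a m u a∈) (trans (cong (_+ m) ∑ν≡n+1) (sym (+-suc n m)))))

allSubsets-split : ∀ l → allSubsets l ≡ Sub.⊥ ∷ filterᵇ nonEmpty (allSubsets l)
allSubsets-split zero    = refl
allSubsets-split (suc l) = begin
  map (outside ∷_) r ++ map (inside ∷_) r
    ≡⟨ cong (λ x → map (outside ∷_) x ++ map (inside ∷_) r) (allSubsets-split l) ⟩
  (outside ∷ Sub.⊥) ∷ map (outside ∷_) (filterᵇ nonEmpty r) ++ map (inside ∷_) r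
    ≡⟨ cong₂ (λ x y → (outside ∷ Sub.⊥) ∷ x ++ y) (sym (outsideFilter r)) (sym (insideFilter r)) ⟩
  (outside ∷ Sub.⊥) ∷ filterᵇ nonEmpty (map (outside ∷_) r) ++ filterᵇ nonEmpty (map (inside ∷_) r)
    ≡⟨ cong ((outside ∷ Sub.⊥) ∷_) (sym (filter-++ _ (map (outside ∷_) r) (map (inside ∷_) r))) ⟩
  (outside ∷ Sub.⊥) ∷ filterᵇ nonEmpty (map (outside ∷_) r ++ map (inside ∷_) r) ∎
  where
  open ≡-Reasoning
  r = allSubsets l
  outsideFilter : ∀ xs → filterᵇ nonEmpty (map (outside ∷_) xs) ≡ map (outside ∷_) (filterᵇ nonEmpty xs)
  outsideFilter []       = refl
  outsideFilter (x ∷ xs) with nonEmpty x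
  ... | true  = cong (_ ∷_) (outsideFilter xs)
  ... | false = outsideFilter xs
  insideFilter : ∀ xs → filterᵇ nonEmpty (map (inside ∷_) xs) ≡ map (inside ∷_) xs
  insideFilter []       = refl
  insideFilter (x ∷ xs) = cong (_ ∷_) (insideFilter xs)

binomial*factorials : ∀ {n s} → s ≤ n → (n choose s) * (s ! * (n ∸ s) !) ≡ n !
binomial*factorials {n} {s} s≤n =
  trans (cong (_* (s ! * (n ∸ s) !)) (nCk≡n!/k![n-k]! s≤n)) (m/n*n≡m {{s !* (n ∸ s) !≢0}} (k![n∸k]!∣n! s≤n))

binomialSplit : ∀ n a s P c .{{_ : NonZero P}} .{{_ : NonZero (a ! * P)}} →
                a + s ≡ n → c * P ≡ s ! → (s ! / P) * (n choose s) ≡ n ! / (a ! * P)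
binomialSplit n a s P c a+s≡n cP≡s! =
  trans (cong (_* (n choose s)) (trans (/-congˡ (sym cP≡s!)) (m*n/n≡m c P)))
        (sym (trans (/-congˡ n!≡) (m*n/n≡m (c * (n choose s)) (a ! * P))))
  where
  s≤n : s ≤ n
  s≤n = subst (s ≤_) a+s≡n (m≤n+m s a)
  n∸s≡a : n ∸ s ≡ a
  n∸s≡a = trans (cong (_∸ s) (sym a+s≡n)) (m+n∸n≡m a s)
  rearrange : ∀ x y z w → x * (y * z * w) ≡ y * x * (w * z)
  rearrange = ℕ-Solver.solve-∀
  n!≡ : n ! ≡ c * (n choose s) * (a ! * P)
  n!≡ = begin
    n !                              ≡⟨ binomial*factorials s≤n ⟨
    (n choose s) * (s ! * (n ∸ s) !) ≡⟨ cong₂ (λ x y → (n choose s) * (x * y !)) (sym cP≡s!) n∸s≡a ⟩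
    (n choose s) * (c * P * a !)     ≡⟨ rearrange (n choose s) c P (a !) ⟩
    c * (n choose s) * (a ! * P)     ∎
    where open ≡-Reasoning

module Profiles (l : ℕ) where
  open Occurrences {Subset l} (≡-dec Bool._≟_) public
  open Multinomial {Subset l} (≡-dec Bool._≟_) public

  S : List (Subset l)
  S = allSubsets l

  S-enumerates : Enumerates S
  S-enumerates = record { unique = allSubsets-unique l ; complete = allSubsets-complete l }

  profile : ∀ {n} → Vec (Subset l) n → Subset l → ℕ
  profile w I = occ I w

  multinomialTerm≡#words : ∀ n ν → sum (map ν S) ≡ n → multinomialTerm n ν ≡ #words S n ν
  multinomialTerm≡#words n ν ∑ν≡n =
    trans (/-congˡ {{nz}} (trans (sym (multinomial (allSubsets-unique l) n ν ∑ν≡n))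
                                  (cong (#words S n ν *_) (cong product (map-∘ S)))))
          (m*n/n≡m (#words S n ν) (prodFact (map ν S)) {{nz}})
    where nz = prodFact≢0 (map ν S)

  -- splitting off the empty set I₁ = ∅: the second form of the summand equals the first
  secondTerm≡multinomialTerm : ∀ n ν → sum (map ν S) ≡ n → secondTerm n ν ≡ multinomialTerm n ν
  secondTerm≡multinomialTerm n ν ∑ν≡n =
    trans (binomialSplit n (ν Sub.⊥) s P (#words R s ν) {{prodFact≢0 (map ν R)}} {{prodFact≢0 (map ν (Sub.⊥ ∷ R))}}
                         ∑ν≡n′ #R*P≡s!)
          (cong (λ xs → (n ! / prodFact (map ν xs)) {{prodFact≢0 (map ν xs)}}) (sym (allSubsets-split l)))
    where
    R = filterᵇ nonEmpty S
    s = sum (map ν R)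
    P = prodFact (map ν R)
    #R*P≡s! : #words R s ν * P ≡ s !
    #R*P≡s! = trans (cong (#words R s ν *_) (sym (cong product (map-∘ R))))
                    (multinomial (Uniqueₚ.filter⁺ _ (allSubsets-unique l)) s ν refl)
    ∑ν≡n′ : ν Sub.⊥ + s ≡ n
    ∑ν≡n′ = trans (cong (λ xs → sum (map ν xs)) (sym (allSubsets-split l))) ∑ν≡n

  profile≤ : ∀ {n} (w : Vec (Subset l) n) I → profile w I ≤ n
  profile≤ {n} w I = subst (profile w I ≤_) (length-toList w) (count≤length I (toList w))

  hasProfile⇒ : ∀ {n} (w : Vec (Subset l) n) ν → hasProfile S w ν ≡ true → ∀ I → profile w I ≡ ν I
  hasProfile⇒ w ν e I = =ℕ-true (all-true⇒ S e (allSubsets-complete l I))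

  inNᵇ-cong : ∀ n d (γ : Vec ℕ l) ν μ → (∀ I → ν I ≡ μ I) → inNᵇ n d γ ν ≡ inNᵇ n d γ μ
  inNᵇ-cong n d γ ν μ ν≗μ = cong₂ _∧_
    (all-cong (allFin l) (λ {i} _ → cong (λ x → ⌊ + x ℤ.≟ + (suc d) ℤ.- + lookup γ i ⌋) (sums (λ I → ⌊ i ∈? I ⌋))))
    (cong₂ _∧_
      (all-cong S (λ {I} _ → cong (λ x → if ⌊ 2 ℕ.≤? ∣ I ∣ ⌋
               then ⌊ + x ℤ.<? + (suc d) ℤ.- + sum (map (lookup γ) (filterᵇ (λ i → ⌊ i ∈? I ⌋) (allFin l))) ⌋
               else true) (sums (λ I′ → ⌊ I ⊆? I′ ⌋))))
      (cong (λ x → ⌊ x ℕ.≟ n ⌋) (sums (λ _ → true))))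
    where
    sums : ∀ p → sumOver p ν ≡ sumOver p μ
    sums p = ∑-cong (filterᵇ p S) (λ {I} _ → ν≗μ I)

  inN⇒sum : ∀ n d (γ : Vec ℕ l) ν → inNᵇ n d γ ν ≡ true → sum (map ν S) ≡ n
  inN⇒sum n d γ ν e = trans (cong (λ xs → sum (map ν xs)) (sym (filterᵇ-true S)))
                            (=ℕ-true (∧-true₂ (∧-true₂ {all _ (allFin l)} e)))

  mapsOn-once : ∀ n (Is : List (Subset l)) → Unique Is → (g : Subset l → ℕ) → (∀ {I} → I ∈ Is → g I ≤ n) →
                ∑[ ν ← mapsOn Is n ] 𝟙 (all (λ I → g I =ℕ ν I) Is) ≡ 1
  mapsOn-once n []       _          g g≤n = refl
  mapsOn-once n (I ∷ Is) u@(_ ∷ u′) g g≤n = begin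
    ∑[ ν ← mapsOn (I ∷ Is) n ] 𝟙 (agrees (I ∷ Is) ν)
      ≡⟨ ∑-concatMap (λ f → map (update f I) (upTo (suc n))) (mapsOn Is n) _ ⟩
    ∑[ f ← mapsOn Is n ] ∑[ ν ← map (update f I) (upTo (suc n)) ] 𝟙 (agrees (I ∷ Is) ν)
      ≡⟨ ∑-cong (mapsOn Is n) (λ {f} _ → choices f) ⟩
    ∑[ f ← mapsOn Is n ] 𝟙 (agrees Is f)
      ≡⟨ mapsOn-once n Is u′ g (g≤n ∘ there) ⟩
    1 ∎
    where
    open ≡-Reasoning
    agrees : List (Subset l) → (Subset l → ℕ) → Bool
    agrees Js ν = all (λ J → g J =ℕ ν J) Js
    offI : ∀ f k → agrees Is (update f I k) ≡ agrees Is f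
    offI f k = all-cong Is (λ {J} J∈ → cong (g J =ℕ_) (≔-other f I k (λ { refl → Uniqueₚ.Unique[x∷xs]⇒x∉xs u J∈ })))
    choices : ∀ f → ∑[ ν ← map (update f I) (upTo (suc n)) ] 𝟙 (agrees (I ∷ Is) ν) ≡ 𝟙 (agrees Is f)
    choices f = begin
      ∑[ ν ← map (update f I) (upTo (suc n)) ] 𝟙 (agrees (I ∷ Is) ν)
        ≡⟨ ∑-map (update f I) (upTo (suc n)) _ ⟩
      ∑[ k ← upTo (suc n) ] 𝟙 ((g I =ℕ update f I k I) ∧ agrees Is (update f I k))
        ≡⟨ ∑-cong (upTo (suc n)) (λ {k} _ → trans (cong₂ (λ x y → 𝟙 ((g I =ℕ x) ∧ y)) (≔-self f I k) (offI f k))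
                                                 (𝟙-∧ (g I =ℕ k) (agrees Is f))) ⟩
      ∑[ k ← upTo (suc n) ] (𝟙 (g I =ℕ k) * 𝟙 (agrees Is f))
        ≡⟨ ∑-*ʳ (upTo (suc n)) (𝟙 (agrees Is f)) (λ k → 𝟙 (g I =ℕ k)) ⟩
      ℕOcc.count (g I) (upTo (suc n)) * 𝟙 (agrees Is f)
        ≡⟨ cong (_* 𝟙 (agrees Is f)) (ℕOcc.count-unique (Uniqueₚ.upTo⁺ (suc n)) (∈-upTo⁺ (s≤s (g≤n (here refl))))) ⟩
      1 * 𝟙 (agrees Is f)
        ≡⟨ +-identityʳ _ ⟩
      𝟙 (agrees Is f) ∎

  ∑N≡#words : ∀ n d (γ : Vec ℕ l) (f : (Subset l → ℕ) → ℕ) →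
              (∀ ν → sum (map ν S) ≡ n → f ν ≡ #words S n ν) →
              sum (map f (N n d γ)) ≡ ∑[ w ← words S n ] 𝟙 (inNᵇ n d γ (profile w))
  ∑N≡#words n d γ f f≡#words = begin
    sum (map f (N n d γ))
      ≡⟨ ∑-filterᵇ (inNᵇ n d γ) (allMaps l n) f ⟩
    ∑[ ν ← allMaps l n ] (𝟙 (inNᵇ n d γ ν) * f ν)
      ≡⟨ ∑-cong (allMaps l n) (λ {ν} _ → wordsOfProfile ν) ⟩
    ∑[ ν ← allMaps l n ] ∑[ w ← words S n ] (𝟙 (hasProfile S w ν) * 𝟙 (inNᵇ n d γ (profile w)))
      ≡⟨ ∑-fibres (λ w ν → hasProfile S w ν) (words S n) (allMaps l n) (λ w → 𝟙 (inNᵇ n d γ (profile w)))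
                  (λ {w} _ → mapsOn-once n S (allSubsets-unique l) (profile w) (λ {I} _ → profile≤ w I)) ⟨
    ∑[ w ← words S n ] 𝟙 (inNᵇ n d γ (profile w)) ∎
    where
    open ≡-Reasoning
    wordsOfProfile : ∀ ν → 𝟙 (inNᵇ n d γ ν) * f ν
                         ≡ ∑[ w ← words S n ] (𝟙 (hasProfile S w ν) * 𝟙 (inNᵇ n d γ (profile w)))
    wordsOfProfile ν = trans countThem (sym (trans (∑-cong (words S n) (λ {w} _ → sameTest w))
                                                   (∑-*ʳ (words S n) (𝟙 (inNᵇ n d γ ν)) _)))
      where
      sameTest : ∀ w → 𝟙 (hasProfile S w ν) * 𝟙 (inNᵇ n d γ (profile w)) ≡ 𝟙 (hasProfile S w ν) * 𝟙 (inNᵇ n d γ ν)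
      sameTest w with hasProfile S w ν in e
      ... | true  = cong (λ b → 𝟙 b + 0) (inNᵇ-cong n d γ (profile w) ν (hasProfile⇒ w ν e))
      ... | false = refl
      countThem : 𝟙 (inNᵇ n d γ ν) * f ν ≡ #words S n ν * 𝟙 (inNᵇ n d γ ν)
      countThem with inNᵇ n d γ ν in ν∈N
      ... | true  = trans (+-identityʳ (f ν)) (trans (f≡#words ν (inN⇒sum n d γ ν ν∈N)) (sym (*-identityʳ _)))
      ... | false = sym (*-zeroʳ (#words S n ν))

transpose : ∀ {A : Set} {m n} → Vec (Vec A m) n → Vec (Vec A n) m
transpose w = tabulate (λ i → Vec.map (λ x → lookup x i) w)

lookup-transpose : ∀ {A : Set} {m n} (w : Vec (Vec A m) n) i j → lookup (lookup (transpose w) i) j ≡ lookup (lookup w j) i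
lookup-transpose w i j = trans (cong (λ v → lookup v j) (lookup∘tabulate _ i)) (lookup-map j (λ x → lookup x i) w)

vec-ext : ∀ {A : Set} {n} {u v : Vec A n} → (∀ i → lookup u i ≡ lookup v i) → u ≡ v
vec-ext {u = u} {v} e = trans (sym (tabulate∘lookup u)) (trans (tabulate-cong e) (tabulate∘lookup v))

transpose-involutive : ∀ {A : Set} {m n} (w : Vec (Vec A m) n) → transpose (transpose w) ≡ w
transpose-involutive w = vec-ext (λ j → vec-ext (λ i → trans (lookup-transpose (transpose w) j i) (lookup-transpose w i j)))

∑-transpose : ∀ l n (F : Vec (Subset n) l → ℕ) →
              ∑[ w ← words (allSubsets l) n ] F (transpose w) ≡ ∑[ T ← words (allSubsets n) l ] F T
∑-transpose l n F = ∑-bijection (≡-dec (≡-dec Bool._≟_)) (≡-dec (≡-dec Bool._≟_))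
  (tuples l n) (tuples n l) transpose transpose transpose-involutive transpose-involutive F
  where
  tuples : ∀ a b → Enumerates (words (allSubsets a) b)
  tuples a b = record { unique   = words-unique _ (allSubsets-unique a) b
                      ; complete = words-complete _ (allSubsets-complete a) b }

select : ∀ {A : Set} {l} → Vec A l → Subset l → List A
select []       []            = []
select (x ∷ xs) (false ∷ I) = select xs I
select (x ∷ xs) (true ∷ I)  = x ∷ select xs I

length-select : ∀ {A : Set} {l} (T : Vec A l) I → length (select T I) ≡ ∣ I ∣
length-select []      []          = refl
length-select (x ∷ T) (false ∷ I) = length-select T I
length-select (x ∷ T) (true ∷ I)  = cong suc (length-select T I)

select-map : ∀ {A B : Set} {l} (f : A → B) (W : Vec A l) I → select (Vec.map f W) I ≡ map f (select W I)
select-map f []      []          = refl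
select-map f (x ∷ W) (false ∷ I) = select-map f W I
select-map f (x ∷ W) (true ∷ I)  = cong (f x ∷_) (select-map f W I)

sublists≡selections : ∀ {A : Set} {l} (T : Vec A l) → sublists (toList T) ≡ map (select T) (allSubsets l)
sublists≡selections []               = refl
sublists≡selections {l = suc l} (x ∷ T) =
  trans (cong₂ (λ a b → a ++ map (x ∷_) b) (sublists≡selections T) (sublists≡selections T))
        (sym (trans (Listₚ.map-++ (select (x ∷ T)) (map (outside ∷_) r) (map (inside ∷_) r))
                    (cong₂ _++_ (sym (Listₚ.map-∘ r)) (trans (sym (Listₚ.map-∘ r)) (Listₚ.map-∘ r)))))
  where r = allSubsets l

∈?-lookup : ∀ {l} (i : Fin l) (x : Subset l) → ⌊ i ∈? x ⌋ ≡ lookup x i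
∈?-lookup zero    (true ∷ x)  = refl
∈?-lookup zero    (false ∷ x) = refl
∈?-lookup (suc i) (b ∷ x) with i ∈? x | ∈?-lookup i x
... | yes _ | e = e
... | no _  | e = e

⊆?-select : ∀ {l} (I x : Subset l) → ⌊ I ⊆? x ⌋ ≡ and (select x I)
⊆?-select []          []          = refl
⊆?-select (false ∷ I) (y ∷ x) with I ⊆? x | ⊆?-select I x
... | yes _ | e = e
... | no _  | e = e
⊆?-select (true ∷ I)  (false ∷ x) = refl
⊆?-select (true ∷ I)  (true ∷ x) with I ⊆? x | ⊆?-select I x
... | yes _ | e = e
... | no _  | e = e

filter-tabulate : ∀ {X A : Set} {k} (g : Fin k → X) (p : X → Bool) (f : X → A) →
                  map f (filterᵇ p (List.tabulate g)) ≡ select (tabulate (f ∘ g)) (tabulate (p ∘ g))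
filter-tabulate {k = zero}  g p f = refl
filter-tabulate {k = suc k} g p f with p (g zero)
... | true  = cong (f (g zero) ∷_) (filter-tabulate (g ∘ suc) p f)
... | false = filter-tabulate (g ∘ suc) p f

select-allFin : ∀ {A : Set} {l} (V : Vec A l) (I : Subset l) →
                map (lookup V) (filterᵇ (λ i → ⌊ i ∈? I ⌋) (allFin l)) ≡ select V I
select-allFin V I = trans (filter-tabulate (λ i → i) (λ i → ⌊ i ∈? I ⌋) (lookup V))
  (cong₂ select (tabulate∘lookup V) (vec-ext (λ i → trans (lookup∘tabulate _ i) (∈?-lookup i I))))

⋂-lookup : ∀ {n} (xs : List (Subset n)) j → lookup (⋂ xs) j ≡ all (λ X → lookup X j) xs
⋂-lookup []       j = lookup-replicate j true
⋂-lookup (X ∷ xs) j = trans (lookup-zipWith _∧_ j X (⋂ xs)) (cong (lookup X j ∧_) (⋂-lookup xs j))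

row-transpose : ∀ {l n} (w : Vec (Subset l) n) i → lookup (transpose w) i ≡ Vec.map (λ x → ⌊ i ∈? x ⌋) w
row-transpose w i = trans (lookup∘tabulate _ i) (Vec.map-cong (λ x → sym (∈?-lookup i x)) w)

⋂-transpose : ∀ {l n} (w : Vec (Subset l) n) (I : Subset l) → ⋂ (select (transpose w) I) ≡ Vec.map (λ x → ⌊ I ⊆? x ⌋) w
⋂-transpose w I = vec-ext atLetter
  where
  open ≡-Reasoning
  column : ∀ j → Vec.map (λ X → lookup X j) (transpose w) ≡ lookup w j
  column j = vec-ext λ i → trans (lookup-map i (λ X → lookup X j) (transpose w)) (lookup-transpose w i j)
  atLetter : ∀ j → lookup (⋂ (select (transpose w) I)) j ≡ lookup (Vec.map (λ x → ⌊ I ⊆? x ⌋) w) j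
  atLetter j = begin
    lookup (⋂ (select (transpose w) I)) j                      ≡⟨ ⋂-lookup (select (transpose w) I) j ⟩
    all (λ X → lookup X j) (select (transpose w) I)            ≡⟨ cong and (sym (select-map (λ X → lookup X j) (transpose w) I)) ⟩
    and (select (Vec.map (λ X → lookup X j) (transpose w)) I)  ≡⟨ cong (λ v → and (select v I)) (column j) ⟩
    and (select (lookup w j) I)                                ≡⟨ sym (⊆?-select I (lookup w j)) ⟩
    ⌊ I ⊆? lookup w j ⌋                                        ≡⟨ sym (lookup-map j (λ x → ⌊ I ⊆? x ⌋) w) ⟩
    lookup (Vec.map (λ x → ⌊ I ⊆? x ⌋) w) j                    ∎

∣map∣ : ∀ {A : Set} {n} (f : A → Bool) (w : Vec A n) → ∣ Vec.map f w ∣ ≡ ∑[ x ← toList w ] 𝟙 (f x)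
∣map∣ f []      = refl
∣map∣ f (x ∷ w) with f x
... | true  = cong suc (∣map∣ f w)
... | false = ∣map∣ f w

module ProfileSums (l : ℕ) where
  open Profiles l

  sumOver-profile : ∀ {n} (p : Subset l → Bool) (w : Vec (Subset l) n) →
                    sumOver p (profile w) ≡ ∣ Vec.map p w ∣
  sumOver-profile p w = begin
    sumOver p (profile w)
      ≡⟨ ∑-filterᵇ p S (profile w) ⟩
    ∑[ I ← S ] (𝟙 (p I) * count I (toList w))
      ≡⟨ ∑-cong S (λ {I} _ → sym (∑-*ˡ (toList w) (𝟙 (p I)) _)) ⟩
    ∑[ I ← S ] ∑[ x ← toList w ] (𝟙 (p I) * 𝟙 (I == x))
      ≡⟨ ∑-swap S (toList w) _ ⟩
    ∑[ x ← toList w ] ∑[ I ← S ] (𝟙 (p I) * 𝟙 (I == x))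
      ≡⟨ ∑-cong (toList w) (λ {x} _ → trans (∑-cong S (λ {I} _ → trans (*-comm (𝟙 (p I)) _)
                                                           (cong (λ b → 𝟙 b * 𝟙 (p I)) (==-sym I x))))
                                            (∑-pick S-enumerates (λ I → 𝟙 (p I)) x)) ⟩
    ∑[ x ← toList w ] 𝟙 (p x)
      ≡⟨ sym (∣map∣ p w) ⟩
    ∣ Vec.map p w ∣ ∎
    where open ≡-Reasoning

⌊⌋-⇔ : ∀ {P Q : Set} → P ⇔ Q → (p : Dec P) (q : Dec Q) → ⌊ p ⌋ ≡ ⌊ q ⌋
⌊⌋-⇔ P⇔Q p q = trans (isYes≗does p) (trans (does-⇔ P⇔Q p q) (sym (isYes≗does q)))

+-∸ : ∀ m n → n ≤ m → + m ℤ.- + n ≡ + (m ∸ n)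
+-∸ m n n≤m = trans (ℤ.m-n≡m⊖n m n) (ℤ.⊖-≥ n≤m)

codim-test : ∀ d k g → 1 ≤ g → ⌊ + k ℤ.≟ + suc d ℤ.- + g ⌋ ≡ (suc d ∸ k =ℕ g)
codim-test d k g 1≤g = ⌊⌋-⇔ (mk⇔ to from) _ _
  where
  to : + k ≡ + suc d ℤ.- + g → suc d ∸ k ≡ g
  to e with g ℕ.≤? suc d
  ... | yes g≤ = trans (cong (suc d ∸_) (ℤ.+-injective (trans e (+-∸ (suc d) g g≤)))) (m∸[m∸n]≡n g≤)
  ... | no g≰ with trans e (trans (ℤ.m-n≡m⊖n (suc d) g) (ℤ.⊖-< (≰⇒> g≰)))
  ...   | e′ with g ∸ suc d | m>n⇒m∸n≢0 (≰⇒> g≰)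
  ...     | zero  | ≢0 = ⊥-elim (≢0 refl)
  ...     | suc _ | _  = case e′
    where case : ∀ {x} → + k ≡ -[1+ x ] → suc d ∸ k ≡ g
          case ()
  from : suc d ∸ k ≡ g → + k ≡ + suc d ℤ.- + g
  from e = trans (cong +_ k≡) (sym (+-∸ (suc d) g g≤))
    where
    g≤ : g ≤ suc d
    g≤ = subst (_≤ suc d) e (m∸n≤m (suc d) k)
    k≤ : k ≤ suc d
    k≤ with k ℕ.≤? suc d
    ... | yes p = p
    ... | no p  = ⊥-elim (<⇒≱ 1≤g (subst (_≤ 0) e (≤-reflexive (m≤n⇒m∸n≡0 (<⇒≤ (≰⇒> p))))))
    k≡ : k ≡ suc d ∸ g
    k≡ = trans (sym (m∸[m∸n]≡n k≤)) (cong (suc d ∸_) e)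

positivity-test : ∀ (K s G : ℤ) → ⌊ K ℤ.<? s ℤ.- G ⌋ ≡ ⌊ + 0 ℤ.<? (s ℤ.- K) ℤ.- G ⌋
positivity-test K s G = ⌊⌋-⇔ (mk⇔ to from) _ _
  where
  swap-sub : ∀ a b c → (a ℤ.- b) ℤ.- c ≡ (a ℤ.- c) ℤ.- b
  swap-sub = ℤ-Solver.solve-∀
  cancel : ∀ a b c → (a ℤ.- b) ℤ.- c ℤ.+ c ≡ a ℤ.- b
  cancel = ℤ-Solver.solve-∀
  to : K ℤ.< s ℤ.- G → + 0 ℤ.< (s ℤ.- K) ℤ.- G
  to p = subst₂ ℤ._<_ (ℤ.+-inverseʳ K) (sym (swap-sub s K G)) (ℤ.+-monoˡ-< (ℤ.- K) p)
  from : + 0 ℤ.< (s ℤ.- K) ℤ.- G → K ℤ.< s ℤ.- G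
  from p = subst₂ ℤ._<_ (ℤ.+-identityˡ K) (cancel s G K) (ℤ.+-monoˡ-< K (subst (+ 0 ℤ.<_) (swap-sub s K G) p))

labelled : ∀ {l n} → ℕ → Vec ℕ l → Vec (Subset n) l → Bool
labelled {l} d γ T = all (λ i → codimℕ d (lookup T i) =ℕ lookup γ i) (allFin l)

cond₁ : ∀ {n} → ℕ → List (Subset n) → Bool
cond₁ d T′ = if ⌊ 1 ℕ.<? length T′ ⌋ then ⌊ + 0 ℤ.<? D d T′ ⌋ else true

Cond₁ : ∀ {n} → ℕ → List (Subset n) → Bool
Cond₁ d xs = all (cond₁ d) (sublists xs)

labelled-facts : ∀ {l n} d (γ : Vec ℕ l) (T : Vec (Subset n) l) → (∀ i → 1 ≤ lookup γ i) →
                 labelled d γ T ≡ true → Vec.map (codimℕ d) T ≡ γ × (∀ i → ∣ lookup T i ∣ ≤ d)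
labelled-facts {l} d γ T γ>0 e = vec-ext (λ i → trans (lookup-map i (codimℕ d) T) (codim≡ i)) , small
  where
  codim≡ : ∀ i → codimℕ d (lookup T i) ≡ lookup γ i
  codim≡ i = =ℕ-true (all-true⇒ (allFin l) e (∈-allFin i))
  small : ∀ i → ∣ lookup T i ∣ ≤ d
  small i with ∣ lookup T i ∣ ℕ.≤? d
  ... | yes p = p
  ... | no p  = ⊥-elim (<⇒≱ (γ>0 i) (subst (_≤ 0) (codim≡ i) (≤-reflexive (m≤n⇒m∸n≡0 (≰⇒> p)))))

labelled-intro : ∀ {l n} d (γ : Vec ℕ l) (T : Vec (Subset n) l) → Vec.map (codimℕ d) T ≡ γ → labelled d γ T ≡ true
labelled-intro {l} d γ T codims = ⇒all-true (allFin l) λ {i} _ →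
  trans (cong (_=ℕ lookup γ i) (trans (sym (lookup-map i (codimℕ d) T)) (cong (λ v → lookup v i) codims))) (=ℕ-refl _)

ρ-select : ∀ {l n} d (T : Vec (Subset n) l) I → (∀ i → ∣ lookup T i ∣ ≤ suc d) →
           ρ d (select T I) ≡ + sum (select (Vec.map (codimℕ d) T) I)
ρ-select d []      []          _     = refl
ρ-select d (x ∷ T) (false ∷ I) small = ρ-select d T I (small ∘ suc)
ρ-select d (x ∷ T) (true ∷ I)  small =
  cong₂ ℤ._+_ (+-∸ (suc d) ∣ x ∣ (small zero)) (ρ-select d T I (small ∘ suc))

module Conversion (l : ℕ) where
  open Profiles l
  open ProfileSums l

  -- condition (a): ∑_{I ∋ i} ν(I) = |T_i|, so (a) says codim(T_i) = γ_i
  condition-a : ∀ {n} d (γ : Vec ℕ l) (w : Vec (Subset l) n) → (∀ i → 1 ≤ lookup γ i) →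
    all (λ i → ⌊ + sumOver (λ I → ⌊ i ∈? I ⌋) (profile w) ℤ.≟ + (suc d) ℤ.- + lookup γ i ⌋) (allFin l)
    ≡ labelled d γ (transpose w)
  condition-a d γ w γ>0 = all-cong (allFin l) λ {i} _ →
    trans (cong (λ k → ⌊ + k ℤ.≟ + (suc d) ℤ.- + lookup γ i ⌋)
                (trans (sumOver-profile _ w) (cong ∣_∣ (sym (row-transpose w i)))))
          (codim-test d _ (lookup γ i) (γ>0 i))

  -- condition (b): ∑_{I' ⊇ I} ν(I') = |⋂_{i∈I} T_i| and ∑_{i∈I} γ_i = ρ_d(T_I),
  -- so (b) for I says D_d(T_I) > 0, i.e. condition (1) for the sub-collection T_I
  condition-b : ∀ {n} d (γ : Vec ℕ l) (w : Vec (Subset l) n) → (∀ i → 1 ≤ lookup γ i) →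
    labelled d γ (transpose w) ≡ true →
    all (λ I → if ⌊ 2 ℕ.≤? ∣ I ∣ ⌋
               then ⌊ + sumOver (λ I′ → ⌊ I ⊆? I′ ⌋) (profile w)
                        ℤ.<? + (suc d) ℤ.- + sum (map (lookup γ) (filterᵇ (λ i → ⌊ i ∈? I ⌋) (allFin l))) ⌋
               else true) S
    ≡ Cond₁ d (toList (transpose w))
  condition-b d γ w γ>0 lab = sym (begin
    all (cond₁ d) (sublists (toList T))      ≡⟨ cong (all (cond₁ d)) (sublists≡selections T) ⟩
    all (cond₁ d) (map (select T) S)        ≡⟨ cong and (sym (map-∘ S)) ⟩
    all (cond₁ d ∘ select T) S              ≡⟨ all-cong S (λ {I} _ → perSubset I) ⟩
    _ ∎)
    where
    open ≡-Reasoning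
    T = transpose w
    facts = labelled-facts d γ T γ>0 lab
    perSubset : ∀ I → cond₁ d (select T I)
                    ≡ (if ⌊ 2 ℕ.≤? ∣ I ∣ ⌋
                       then ⌊ + sumOver (λ I′ → ⌊ I ⊆? I′ ⌋) (profile w)
                                ℤ.<? + (suc d) ℤ.- + sum (map (lookup γ) (filterᵇ (λ i → ⌊ i ∈? I ⌋) (allFin l))) ⌋
                       else true)
    perSubset I = cong₂ (λ b x → if b then x else true) (cong (λ m → ⌊ 2 ℕ.≤? m ⌋) (length-select T I))
      (sym (trans (cong₂ (λ K G → ⌊ + K ℤ.<? + (suc d) ℤ.- + G ⌋) K≡ G≡)
           (trans (positivity-test (+ ∣ ⋂ (select T I) ∣) (+ suc d) (+ sum (select γ I)))
                  (cong (λ r → ⌊ + 0 ℤ.<? (+ suc d ℤ.- + ∣ ⋂ (select T I) ∣) ℤ.- r ⌋) (sym ρ≡)))))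
      where
      K≡ : sumOver (λ I′ → ⌊ I ⊆? I′ ⌋) (profile w) ≡ ∣ ⋂ (select T I) ∣
      K≡ = trans (sumOver-profile _ w) (cong ∣_∣ (sym (⋂-transpose w I)))
      G≡ : sum (map (lookup γ) (filterᵇ (λ i → ⌊ i ∈? I ⌋) (allFin l))) ≡ sum (select γ I)
      G≡ = cong sum (select-allFin γ I)
      ρ≡ : ρ d (select T I) ≡ + sum (select γ I)
      ρ≡ = trans (ρ-select d T I (m≤n⇒m≤1+n ∘ proj₂ facts)) (cong (λ v → + sum (select v I)) (proj₁ facts))

  condition-c : ∀ {n} (w : Vec (Subset l) n) → ⌊ sumOver (λ _ → true) (profile w) ℕ.≟ n ⌋ ≡ true
  condition-c {n} w = trans (cong (λ k → ⌊ k ℕ.≟ n ⌋) (trans (sumOver-profile _ w) (∣all∣ w))) (=ℕ-refl n)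
    where
    ∣all∣ : ∀ {k} (v : Vec (Subset l) k) → ∣ Vec.map (λ _ → true) v ∣ ≡ k
    ∣all∣ []      = refl
    ∣all∣ (x ∷ v) = cong suc (∣all∣ v)

  N⇔transpose : ∀ n d (γ : Vec ℕ l) (w : Vec (Subset l) n) → (∀ i → 1 ≤ lookup γ i) →
                inNᵇ n d γ (profile w) ≡ labelled d γ (transpose w) ∧ Cond₁ d (toList (transpose w))
  N⇔transpose n d γ w γ>0 with labelled d γ (transpose w) in lab
  ... | true  = cong₂ _∧_ (trans (condition-a d γ w γ>0) lab)
                          (trans (cong₂ _∧_ (condition-b d γ w γ>0 lab) (condition-c w)) (Bool.∧-identityʳ _))
  ... | false = ∧-false {all _ (allFin l)} (trans (condition-a d γ w γ>0) lab)

Unique-resp-↭ : ∀ {A : Set} {xs ys : List A} → xs ↭ ys → Unique xs → Unique ys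
Unique-resp-↭ {A} p = PermSetoid.Unique-resp-↭ (setoid A) (↭⇒↭ₛ p)

same-members⇒↭ : ∀ {A : Set} {xs ys : List A} → Unique xs → Unique ys → (∀ {a} → a ∈ xs ⇔ a ∈ ys) → xs ↭ ys
same-members⇒↭ {xs = []}     {[]}     _ _ _ = ↭-refl
same-members⇒↭ {xs = []}     {y ∷ ys} _ _ same with Equivalence.from same (here refl)
... | ()
same-members⇒↭ {xs = x ∷ xs} {ys} ux@(_ ∷ ux′) uy same
  with ys₁ , ys₂ , refl ← ∈-∃++ (Equivalence.to same (here refl)) =
  ↭-trans (prep x (same-members⇒↭ ux′ uys′ (mk⇔ to from))) (↭-sym (shift x ys₁ ys₂))
  where
  ys′ = ys₁ ++ ys₂
  u′ : Unique (x ∷ ys′)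
  u′ = Unique-resp-↭ (shift x ys₁ ys₂) uy
  uys′ : Unique ys′
  uys′ with u′
  ... | _ ∷ u = u
  to : ∀ {a} → a ∈ xs → a ∈ ys′
  to a∈ with ∈-resp-↭ (shift x ys₁ ys₂) (Equivalence.to same (there a∈))
  ... | here refl = ⊥-elim (Unique[x∷xs]⇒x∉xs ux a∈)
  ... | there a∈′ = a∈′
  from : ∀ {a} → a ∈ ys′ → a ∈ xs
  from a∈ with Equivalence.from same (∈-resp-↭ (↭-sym (shift x ys₁ ys₂)) (there a∈))
  ... | here refl = ⊥-elim (Unique[x∷xs]⇒x∉xs u′ a∈)
  ... | there a∈′ = a∈′

⋂-↭ : ∀ {n} {xs ys : List (Subset n)} → xs ↭ ys → ⋂ xs ≡ ⋂ ys
⋂-↭ ↭.refl         = refl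
⋂-↭ (prep x q)     = cong (x ∩_) (⋂-↭ q)
⋂-↭ (swap {ys = ys} x y q) = trans (cong (λ r → x ∩ (y ∩ r)) (⋂-↭ q)) (∩-swap x y (⋂ ys))
  where
  ∩-swap : ∀ a b c → a ∩ (b ∩ c) ≡ b ∩ (a ∩ c)
  ∩-swap a b c = trans (sym (Sub.∩-assoc a b c)) (trans (cong (_∩ c) (Sub.∩-comm a b)) (Sub.∩-assoc b a c))
⋂-↭ (↭.trans q₁ q₂) = trans (⋂-↭ q₁) (⋂-↭ q₂)

ρ-↭ : ∀ {n} d {xs ys : List (Subset n)} → xs ↭ ys → ρ d xs ≡ ρ d ys
ρ-↭ d ↭.refl        = refl
ρ-↭ d (prep x q)    = cong (λ r → codim d x ℤ.+ r) (ρ-↭ d q)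
ρ-↭ d (swap {ys = ys} x y q) =
  trans (cong (λ r → codim d x ℤ.+ (codim d y ℤ.+ r)) (ρ-↭ d q)) (+-swap (codim d x) (codim d y) (ρ d ys))
  where
  +-swap : ∀ a b c → a ℤ.+ (b ℤ.+ c) ≡ b ℤ.+ (a ℤ.+ c)
  +-swap = ℤ-Solver.solve-∀
ρ-↭ d (↭.trans q₁ q₂) = trans (ρ-↭ d q₁) (ρ-↭ d q₂)

cond₁-↭ : ∀ {n} d {xs ys : List (Subset n)} → xs ↭ ys → cond₁ d xs ≡ cond₁ d ys
cond₁-↭ d q = cong₂ (λ m D′ → if′ m D′) (↭-length q) (cong₂ (λ a b → codim d a ℤ.- b) (⋂-↭ q) (ρ-↭ d q))
  where
  if′ : ℕ → ℤ → Bool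
  if′ m D′ = if ⌊ 1 ℕ.<? m ⌋ then ⌊ + 0 ℤ.<? D′ ⌋ else true

Cond₁-↭ : ∀ {n} d {xs ys : List (Subset n)} → xs ↭ ys → Cond₁ d xs ≡ Cond₁ d ys
Cond₁-↭ d q = ≡true-⇔ (transport q) (transport (↭-sym q))
  where
  transport : ∀ {xs ys} → xs ↭ ys → Cond₁ d xs ≡ true → Cond₁ d ys ≡ true
  transport {xs} {ys} q c = ⇒all-true (sublists ys) λ Z∈ →
    let W , W∈ , Z↭W = sublists-↭ (↭-sym q) Z∈ in trans (cond₁-↭ d Z↭W) (all-true⇒ (sublists xs) c W∈)

-- a set of size ≤ d listed twice has D_d < 0, violating condition (1)
cond₁-twice : ∀ {n} d (x : Subset n) → ∣ x ∣ ≤ d → cond₁ d (x ∷ x ∷ []) ≡ false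
cond₁-twice d x small = cong (λ z → ⌊ + 0 ℤ.<? z ⌋) D≡
  where
  k = d ∸ ∣ x ∣
  codim≡ : codim d x ≡ + suc k
  codim≡ = trans (+-∸ (suc d) ∣ x ∣ (m≤n⇒m≤1+n small)) (cong +_ (+-∸-assoc 1 small))
  x∩x∩⊤ : x ∩ (x ∩ Sub.⊤) ≡ x
  x∩x∩⊤ = trans (cong (x ∩_) (Sub.∩-identityʳ x)) (Sub.∩-idem x)
  negate : ∀ a → a ℤ.- (a ℤ.+ (a ℤ.+ + 0)) ≡ ℤ.- a
  negate = ℤ-Solver.solve-∀
  D≡ : D d (x ∷ x ∷ []) ≡ -[1+ k ]
  D≡ = trans (cong₂ (λ a b → a ℤ.- (b ℤ.+ (b ℤ.+ + 0))) (trans (cong (codim d) x∩x∩⊤) codim≡) codim≡) (negate (+ suc k))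

Cond₁⇒Unique : ∀ {n} d (xs : List (Subset n)) → Cond₁ d xs ≡ true → (∀ {X} → X ∈ xs → ∣ X ∣ ≤ d) → Unique xs
Cond₁⇒Unique d []       _ _     = []
Cond₁⇒Unique d (x ∷ xs) c small =
  All.tabulate (λ a∈ → λ { refl → repeated a∈ })
  ∷ Cond₁⇒Unique d xs (⇒all-true (sublists xs) (λ Z∈ → all-true⇒ (sublists (x ∷ xs)) c (skip x xs Z∈))) (small ∘ there)
  where
  repeated : x ∈ xs → ⊥
  repeated x∈ with trans (sym (all-true⇒ (sublists (x ∷ xs)) c (keep x xs (singleton-sublist x∈))))
                         (cond₁-twice d x (small (here refl)))
  ... | ()

multiplicity : ℕ → List ℕ → ℕ
multiplicity k xs = length (filterᵇ (λ x → ⌊ x ℕ.≟ k ⌋) xs)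

multiplicity-↭ : ∀ k {xs ys} → xs ↭ ys → multiplicity k xs ≡ multiplicity k ys
multiplicity-↭ k q = ↭ₚ.↭-length (↭ₚ.filter-↭ _ q)

∏mult! : List ℕ → List ℕ → ℕ
∏mult! K xs = product (map (λ k → multiplicity k xs !) K)

∏mult!-∷ : ∀ {K} → Unique K → ∀ {g} xs → g ∈ K → ∏mult! K (g ∷ xs) ≡ multiplicity g (g ∷ xs) * ∏mult! K xs
∏mult!-∷ {k ∷ K} u {g} xs (here refl) with g ℕ.≟ g
... | no g≢g = ⊥-elim (g≢g refl)
... | yes _  = trans (cong (suc m * m ! *_) (others K (Unique[x∷xs]⇒x∉xs u))) (*-assoc (suc m) (m !) (∏mult! K xs))
  where
  m = multiplicity g xs
  others : ∀ K′ → g ∉ K′ → product (map (λ k → multiplicity k (g ∷ xs) !) K′) ≡ ∏mult! K′ xs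
  others []       _  = refl
  others (k ∷ K′) g∉ with g ℕ.≟ k
  ... | yes refl = ⊥-elim (g∉ (here refl))
  ... | no _     = cong (multiplicity k xs ! *_) (others K′ (g∉ ∘ there))
∏mult!-∷ {k ∷ K} u@(_ ∷ u′) {g} xs (there g∈) with g ℕ.≟ k
... | yes refl = ⊥-elim (Unique[x∷xs]⇒x∉xs u g∈)
... | no _     = trans (cong (multiplicity k xs ! *_) (∏mult!-∷ u′ xs g∈))
                       (trans (sym (*-assoc (multiplicity k xs !) _ _))
                              (trans (cong (_* ∏mult! K xs) (*-comm (multiplicity k xs !) (multiplicity g (g ∷ xs))))
                                     (*-assoc (multiplicity g (g ∷ xs)) (multiplicity k xs !) (∏mult! K xs))))

-- Counting the ways to list a finite collection, without repetition, with a
-- prescribed sequence of labels c(T_i) = γ_i: the members of each label k can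
-- be arranged in m_k(γ)! ways.
module LabelledListings {A : Set} (_≟_ : DecidableEquality A) (c : A → ℕ) {U : List A} (U-enum : Enumerates U) where
  open Occurrences _≟_
  open Enumerates U-enum

  _without_ : (A → Bool) → A → (A → Bool)
  (m without X) Y = m Y ∧ not (Y == X)

  lists : ∀ {l} → (A → Bool) → Vec A l → Vec ℕ l → Bool
  lists m []      []      = all (not ∘ m) U
  lists m (X ∷ T) (g ∷ γ) = (m X ∧ (c X =ℕ g)) ∧ lists (m without X) T γ

  #listings : ∀ l → (A → Bool) → Vec ℕ l → ℕ
  #listings l m γ = ∑[ T ← words U l ] 𝟙 (lists m T γ)

  #listings-∷ : ∀ l m g (γ : Vec ℕ l) →
                #listings (suc l) m (g ∷ γ) ≡ ∑[ X ← U ] (𝟙 (m X ∧ (c X =ℕ g)) * #listings l (m without X) γ)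
  #listings-∷ l m g γ =
    trans (∑-concatMap (λ X → map (X ∷_) (words U l)) U (λ T → 𝟙 (lists m T (g ∷ γ))))
          (∑-cong U λ {X} _ → trans (∑-map (X ∷_) (words U l) (λ T → 𝟙 (lists m T (g ∷ γ))))
                                    (trans (∑-cong (words U l) (λ {T} _ → 𝟙-∧ (m X ∧ (c X =ℕ g)) (lists (m without X) T γ)))
                                           (∑-*ˡ (words U l) (𝟙 (m X ∧ (c X =ℕ g))) _)))

  not-==-true : ∀ {Y X} → not (Y == X) ≡ true → ¬ Y ≡ X
  not-==-true {Y} e refl rewrite ==-refl Y = case e
    where case : false ≡ true → ⊥
          case ()

  lists⇔ : ∀ {l} m (T : Vec A l) γ →
           lists m T γ ≡ true ⇔ (Unique (toList T) × (∀ {Y} → Y ∈ toList T ⇔ m Y ≡ true) × Vec.map c T ≡ γ)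
  lists⇔ m [] [] = mk⇔ to from
    where
    to : all (not ∘ m) U ≡ true → _
    to e = [] , (λ {Y} → mk⇔ (λ ()) (λ mY → ⊥-elim (absent Y mY))) , refl
      where
      absent : ∀ Y → m Y ≡ true → ⊥
      absent Y mY with trans (sym (all-true⇒ U e (complete Y))) (cong not mY)
      ... | ()
    from : _ → all (not ∘ m) U ≡ true
    from (_ , members , _) = ⇒all-true U λ {Y} _ → absent Y (m Y) refl
      where
      absent : ∀ Y b → m Y ≡ b → not b ≡ true
      absent Y false _  = refl
      absent Y true  mY with Equivalence.from members mY
      ... | ()
  lists⇔ m (X ∷ T) (g ∷ γ) = mk⇔ to from
    where
    module IH = Equivalence (lists⇔ (m without X) T γ)
    to : lists m (X ∷ T) (g ∷ γ) ≡ true → _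
    to e = All.tabulate (λ Y∈ X≡Y → X∉T (subst (_∈ toList T) (sym X≡Y) Y∈)) ∷ uT
         , (λ {Y} → mk⇔ (members⇒ {Y}) (⇒members {Y}))
         , cong₂ _∷_ (=ℕ-true (∧-true₂ {m X} (∧-true₁ {m X ∧ (c X =ℕ g)} e))) mapT
      where
      mX = ∧-true₁ (∧-true₁ {m X ∧ (c X =ℕ g)} e)
      uT = Data.Product.proj₁ (IH.to (∧-true₂ e))
      rest = Data.Product.proj₁ (Data.Product.proj₂ (IH.to (∧-true₂ e)))
      mapT = Data.Product.proj₂ (Data.Product.proj₂ (IH.to (∧-true₂ e)))
      X∉T : X ∉ toList T
      X∉T X∈ = not-==-true (∧-true₂ (Equivalence.to rest X∈)) refl
      members⇒ : ∀ {Y} → Y ∈ X ∷ toList T → m Y ≡ true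
      members⇒ (here refl) = mX
      members⇒ (there Y∈) = ∧-true₁ (Equivalence.to rest Y∈)
      ⇒members : ∀ {Y} → m Y ≡ true → Y ∈ X ∷ toList T
      ⇒members {Y} mY with Y ≟ X
      ... | yes refl = here refl
      ... | no Y≢X   = there (Equivalence.from rest (∧-intro mY (cong not (==-false Y≢X))))
    from : _ → lists m (X ∷ T) (g ∷ γ) ≡ true
    from (u@(_ ∷ uT) , members , mapXT) =
      ∧-intro (∧-intro (Equivalence.to members (here refl)) (trans (cong (_=ℕ g) (cong Vec.head mapXT)) (=ℕ-refl g)))
              (IH.from (uT , (λ {Y} → mk⇔ (rest⇒ {Y}) (⇒rest {Y})) , cong Vec.tail mapXT))
      where
      rest⇒ : ∀ {Y} → Y ∈ toList T → (m without X) Y ≡ true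
      rest⇒ {Y} Y∈ = ∧-intro (Equivalence.to members (there Y∈))
                             (cong not (==-false (λ { refl → Unique[x∷xs]⇒x∉xs u Y∈ })))
      ⇒rest : ∀ {Y} → (m without X) Y ≡ true → Y ∈ toList T
      ⇒rest {Y} e with Equivalence.from members (∧-true₁ e)
      ... | here refl = ⊥-elim (not-==-true (∧-true₂ e) refl)
      ... | there Y∈  = Y∈

  filter-without : ∀ {V} → Unique V → ∀ m {X} → X ∈ V → m X ≡ true → filterᵇ m V ↭ X ∷ filterᵇ (m without X) V
  filter-without {X ∷ V} u m (here refl) mX rewrite mX | ==-refl X =
    prep X (↭-reflexive (filterᵇ-cong V (λ {Y} Y∈ → sym (same Y∈))))
    where
    same : ∀ {Y} → Y ∈ V → (m without X) Y ≡ m Y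
    same {Y} Y∈ rewrite ==-false {Y} {X} (λ { refl → Unique[x∷xs]⇒x∉xs u Y∈ }) = Bool.∧-identityʳ (m Y)
  filter-without {Y ∷ V} u@(_ ∷ u′) m {X} (there X∈) mX with m Y in mY | Y ≟ X
  ... | _     | yes refl = ⊥-elim (Unique[x∷xs]⇒x∉xs u X∈)
  ... | true  | no _     = ↭-trans (prep Y (filter-without u′ m X∈ mX)) (swap Y X ↭-refl)
  ... | false | no _     = filter-without u′ m X∈ mX

  #label : ∀ m g V → ∑[ X ← V ] 𝟙 (m X ∧ (c X =ℕ g)) ≡ multiplicity g (map c (filterᵇ m V))
  #label m g []      = refl
  #label m g (Y ∷ V) with m Y
  ... | false = #label m g V
  ... | true with c Y =ℕ g
  ...   | true  = cong suc (#label m g V)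
  ...   | false = #label m g V

  none⇒[] : ∀ (m : A → Bool) V → all (not ∘ m) V ≡ true → filterᵇ m V ≡ []
  none⇒[] m []      _ = refl
  none⇒[] m (Y ∷ V) e with m Y
  ... | false = none⇒[] m V e

  []⇒none : ∀ (m : A → Bool) V → filterᵇ m V ≡ [] → all (not ∘ m) V ≡ true
  []⇒none m []      _ = refl
  []⇒none m (Y ∷ V) e with m Y
  ... | false = []⇒none m V e

  map≡[] : ∀ xs → map c xs ≡ [] → xs ≡ []
  map≡[] [] _ = refl

  #listings-type : ∀ {K} → Unique K → ∀ l m (γ : Vec ℕ l) → map c (filterᵇ m U) ↭ toList γ →
                   (∀ {k} → k ∈ toList γ → k ∈ K) → #listings l m γ ≡ ∏mult! K (toList γ)
  #listings-type {K} uK zero m [] q _ =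
    trans (cong (λ b → 𝟙 b + 0) ([]⇒none m U (map≡[] (filterᵇ m U) (↭ₚ.↭-empty-inv q)))) (sym (productOfOnes K))
    where
    productOfOnes : ∀ K′ → ∏mult! K′ [] ≡ 1
    productOfOnes []       = refl
    productOfOnes (k ∷ K′) = trans (+-identityʳ _) (productOfOnes K′)
  #listings-type {K} uK (suc l) m (g ∷ γ) q γ⊆K = begin
    #listings (suc l) m (g ∷ γ)
      ≡⟨ #listings-∷ l m g γ ⟩
    ∑[ X ← U ] (𝟙 (m X ∧ (c X =ℕ g)) * #listings l (m without X) γ)
      ≡⟨ ∑-cong U (λ {X} X∈ → byInduction X X∈) ⟩
    ∑[ X ← U ] (𝟙 (m X ∧ (c X =ℕ g)) * ∏mult! K (toList γ))
      ≡⟨ ∑-*ʳ U (∏mult! K (toList γ)) (λ X → 𝟙 (m X ∧ (c X =ℕ g))) ⟩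
    ∑[ X ← U ] 𝟙 (m X ∧ (c X =ℕ g)) * ∏mult! K (toList γ)
      ≡⟨ cong (_* ∏mult! K (toList γ)) (trans (#label m g U) (multiplicity-↭ g q)) ⟩
    multiplicity g (g ∷ toList γ) * ∏mult! K (toList γ)
      ≡⟨ ∏mult!-∷ uK (toList γ) (γ⊆K (here refl)) ⟨
    ∏mult! K (g ∷ toList γ) ∎
    where
    open ≡-Reasoning
    byInduction : ∀ X → X ∈ U → 𝟙 (m X ∧ (c X =ℕ g)) * #listings l (m without X) γ
                                ≡ 𝟙 (m X ∧ (c X =ℕ g)) * ∏mult! K (toList γ)
    byInduction X X∈ with m X ∧ (c X =ℕ g) in e
    ... | false = refl
    ... | true  = cong (_+ 0) (#listings-type uK l (m without X) γ q′ (γ⊆K ∘ there))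
      where
      q′ : map c (filterᵇ (m without X) U) ↭ toList γ
      q′ = ↭ₚ.drop-∷ (↭-trans (↭-reflexive (cong (_∷ _) (sym (=ℕ-true (∧-true₂ {m X} e)))))
                             (↭-trans (↭-sym (↭ₚ.map⁺ c (filter-without unique m X∈ (∧-true₁ e)))) q))

  #listings-other : ∀ l m (γ : Vec ℕ l) → ¬ (map c (filterᵇ m U) ↭ toList γ) → #listings l m γ ≡ 0
  #listings-other zero m [] ¬q with all (not ∘ m) U in e
  ... | false = refl
  ... | true  = ⊥-elim (¬q (↭-reflexive (cong (map c) (none⇒[] m U e))))
  #listings-other (suc l) m (g ∷ γ) ¬q =
    trans (#listings-∷ l m g γ) (trans (∑-cong U (λ {X} X∈ → byInduction X X∈)) (∑-zero U))
    where
    byInduction : ∀ X → X ∈ U → 𝟙 (m X ∧ (c X =ℕ g)) * #listings l (m without X) γ ≡ 0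
    byInduction X X∈ with m X ∧ (c X =ℕ g) in e
    ... | false = refl
    ... | true  = cong (_+ 0) (#listings-other l (m without X) γ ¬q′)
      where
      ¬q′ : ¬ (map c (filterᵇ (m without X) U) ↭ toList γ)
      ¬q′ q′ = ¬q (↭-trans (↭ₚ.map⁺ c (filter-without unique m X∈ (∧-true₁ e)))
                           (↭-trans (↭-reflexive (cong (_∷ _) (=ℕ-true (∧-true₂ {m X} e)))) (prep g q′)))

private
  ≤-order = DecTotalOrder.totalOrder ≤-decTotalOrder

sorted-unique : ∀ {xs ys} → Sorted ≤-order xs → Sorted ≤-order ys → xs ↭ ys → xs ≡ ys
sorted-unique xs↗ ys↗ p = Pointwise-≡⇒≡ (↗↭↗⇒≋ ≤-order xs↗ ys↗ (↭⇒↭ₛ p))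

non-increasing : ∀ {l} (γ : Vec ℕ l) → (∀ i j → toℕ i ≤ toℕ j → lookup γ j ≤ lookup γ i) →
                 AllPairs (λ a b → b ≤ a) (toList γ)
non-increasing []      _    = []
non-increasing (a ∷ γ) mono =
  bounded γ (λ j → mono zero (suc j) z≤n) ∷ non-increasing γ (λ i j p → mono (suc i) (suc j) (s≤s p))
  where
  bounded : ∀ {k} (δ : Vec ℕ k) → (∀ j → lookup δ j ≤ a) → All (λ b → b ≤ a) (toList δ)
  bounded []      f = []
  bounded (b ∷ δ) f = f zero ∷ bounded δ (λ j → f (suc j))

reverse-sorted : ∀ {xs : List ℕ} → AllPairs (λ a b → b ≤ a) xs → AllPairs _≤_ (reverse xs)
reverse-sorted {[]}     []       = []
reverse-sorted {x ∷ xs} (px ∷ p) = subst (AllPairs _≤_) (sym (Listₚ.unfold-reverse x xs))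
  (AllPairs.++⁺ (reverse-sorted p) ([] ∷ []) (↭ₚ.All-resp-↭ (↭-sym (↭ₚ.↭-reverse xs)) (singletons px)))
  where
  singletons : ∀ {ys} → All (λ b → b ≤ x) ys → All (λ y → All (y ≤_) (x ∷ [])) ys
  singletons []       = []
  singletons (q ∷ qs) = (q ∷ []) ∷ singletons qs

reverse-sort⇔↭ : ∀ L {γs} → AllPairs (λ a b → b ≤ a) γs → (reverse (sort L) ≡ γs) ⇔ (L ↭ γs)
reverse-sort⇔↭ L {γs} γs↘ = mk⇔ to from
  where
  to : reverse (sort L) ≡ γs → L ↭ γs
  to e = subst (L ↭_) e (↭-trans (↭-sym (sort-↭ L)) (↭-sym (↭ₚ.↭-reverse (sort L))))
  from : L ↭ γs → reverse (sort L) ≡ γs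
  from p = trans (cong reverse sorted≡) (Listₚ.reverse-involutive γs)
    where
    sorted≡ : sort L ≡ reverse γs
    sorted≡ = sorted-unique (sort-↗ L) (AllPairs⇒Sorted ≤-order (reverse-sorted γs↘))
                            (↭-trans (sort-↭ L) (↭-trans p (↭-sym (↭ₚ.↭-reverse γs))))

typeOf⇔↭ : ∀ {n l} d (C : List (Subset n)) (γ : Vec ℕ l) → 1 ≤ l → (∀ i → 1 ≤ lookup γ i) →
           (∀ i j → toℕ i ≤ toℕ j → lookup γ j ≤ lookup γ i) →
           (typeOf d C ≡ toList γ) ⇔ (map (codimℕ d) C ↭ toList γ)
typeOf⇔↭ d [] []      () _   _
typeOf⇔↭ d [] (g ∷ γ) _  γ>0 _ = mk⇔ to from
  where
  to : 0 ∷ [] ≡ g ∷ toList γ → [] ↭ g ∷ toList γ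
  to e with subst (1 ≤_) (sym (Listₚ.∷-injectiveˡ e)) (γ>0 zero)
  ... | ()
  from : [] ↭ g ∷ toList γ → 0 ∷ [] ≡ g ∷ toList γ
  from p with ↭ₚ.↭-length p
  ... | ()
typeOf⇔↭ d C@(_ ∷ _) γ l≥1 γ>0 mono = reverse-sort⇔↭ (map (codimℕ d) C) (non-increasing γ mono)

∈-toList : ∀ {A : Set} {l} (v : Vec A l) {x} → x ∈ toList v → ∃[ i ] lookup v i ≡ x
∈-toList (y ∷ v) (here refl) = zero , refl
∈-toList (y ∷ v) (there x∈)  = let i , e = ∈-toList v x∈ in suc i , e

≤?-true : ∀ {m n} → m ≤ n → ⌊ m ℕ.≤? n ⌋ ≡ true
≤?-true {m} {n} m≤n with m ℕ.≤? n
... | yes _  = refl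
... | no m≰n = ⊥-elim (m≰n m≤n)

∣∣≡0⇒⊥ : ∀ {n} (X : Subset n) → ∣ X ∣ ≡ 0 → X ≡ Sub.⊥
∣∣≡0⇒⊥ []          _ = refl
∣∣≡0⇒⊥ (false ∷ X) e = cong (false ∷_) (∣∣≡0⇒⊥ X e)

module Collections (n d : ℕ) where
  U : List (Subset n)
  U = allSubsets n

  c : Subset n → ℕ
  c = codimℕ d

  open Profiles n using (S-enumerates) renaming (_==_ to _==ₛ_; ==-refl to ==ₛ-refl; ==-true to ==ₛ-true; ∑-pick to ∑-pickₛ)
  open SubCollections {Subset n} (≡-dec Bool._≟_)
  open LabelledListings {Subset n} (≡-dec Bool._≟_) c S-enumerates
  module Coll = Occurrences {List (Subset n)} (Listₚ.≡-dec (≡-dec Bool._≟_))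

  entries : ∀ {l} → Vec (Subset n) l → List (Subset n)
  entries T = filterᵇ (isIn (toList T)) U

  ∑-by-entries : ∀ l (F : Vec (Subset n) l → ℕ) →
                 ∑ (words U l) F ≡ ∑[ C ← sublists U ] ∑[ T ← words U l ] (𝟙 (entries T Coll.== C) * F T)
  ∑-by-entries l F = ∑-fibres (λ T C → entries T Coll.== C) (words U l) (sublists U) F
    (λ {T} _ → Coll.count-unique (sublists-unique (allSubsets-unique n)) (filterᵇ-sublist _ U))

  entries⇔ : ∀ {l} (T : Vec (Subset n) l) {C} → C ∈ sublists U →
             (entries T Coll.== C) ≡ true ⇔ (∀ {Y} → Y ∈ toList T ⇔ Y ∈ C)
  entries⇔ T {C} C⊆U = mk⇔ to from
    where
    to : (entries T Coll.== C) ≡ true → ∀ {Y} → Y ∈ toList T ⇔ Y ∈ C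
    to e {Y} rewrite sym (Coll.==-true e) =
      mk⇔ (λ Y∈ → ∈-filterᵇ⁺ _ (allSubsets-complete n Y) (Equivalence.from isIn⇔ Y∈))
          (λ Y∈ → Equivalence.to isIn⇔ (proj₂ (∈-filterᵇ⁻ (isIn (toList T)) {U} Y∈)))
    from : (∀ {Y} → Y ∈ toList T ⇔ Y ∈ C) → (entries T Coll.== C) ≡ true
    from same = subst (λ Z → (Z Coll.== C) ≡ true) entries≡C (Coll.==-refl C)
      where
      sameTest : ∀ {Y} → Y ∈ U → isIn C Y ≡ isIn (toList T) Y
      sameTest _ = ≡true-⇔ (Equivalence.from isIn⇔ ∘ Equivalence.from same ∘ Equivalence.to isIn⇔)
                           (Equivalence.from isIn⇔ ∘ Equivalence.to same ∘ Equivalence.to isIn⇔)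
      entries≡C : C ≡ entries T
      entries≡C = trans (sublist-as-filter (allSubsets-unique n) C⊆U) (filterᵇ-cong U sameTest)

  tuple⇔listing : ∀ {l} (γ : Vec ℕ l) → (∀ i → 1 ≤ lookup γ i) → (T : Vec (Subset n) l) → ∀ {C} → C ∈ sublists U →
    ((entries T Coll.== C) ∧ (labelled d γ T ∧ Cond₁ d (toList T))) ≡ (inLᵇ d C ∧ lists (isIn C) T γ)
  tuple⇔listing γ γ>0 T {C} C⊆U = ≡true-⇔ to from
    where
    uC = sublist-unique (allSubsets-unique n) C⊆U
    membersT⇔ : (∀ {Y} → Y ∈ toList T ⇔ Y ∈ C) → ∀ {Y} → Y ∈ toList T ⇔ isIn C Y ≡ true
    membersT⇔ same = mk⇔ (Equivalence.from isIn⇔ ∘ Equivalence.to same) (Equivalence.from same ∘ Equivalence.to isIn⇔)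
    to : ((entries T Coll.== C) ∧ (labelled d γ T ∧ Cond₁ d (toList T))) ≡ true → (inLᵇ d C ∧ lists (isIn C) T γ) ≡ true
    to e = ∧-intro (∧-intro (trans (sym (Cond₁-↭ d T↭C)) cond₁T)
                            (⇒all-true C (λ X∈ → ≤?-true (smallT (Equivalence.from same X∈)))))
                   (Equivalence.from (lists⇔ (isIn C) T γ) (uT , membersT⇔ same , proj₁ facts))
      where
      same = Equivalence.to (entries⇔ T C⊆U) (∧-true₁ e)
      facts = labelled-facts d γ T γ>0 (∧-true₁ (∧-true₂ {entries T Coll.== C} e))
      cond₁T = ∧-true₂ {labelled d γ T} (∧-true₂ {entries T Coll.== C} e)
      smallT : ∀ {X} → X ∈ toList T → ∣ X ∣ ≤ d
      smallT X∈ = let i , e′ = ∈-toList T X∈ in subst (λ Z → ∣ Z ∣ ≤ d) e′ (proj₂ facts i)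
      uT = Cond₁⇒Unique d (toList T) cond₁T smallT
      T↭C = same-members⇒↭ uT uC same
    from : (inLᵇ d C ∧ lists (isIn C) T γ) ≡ true → ((entries T Coll.== C) ∧ (labelled d γ T ∧ Cond₁ d (toList T))) ≡ true
    from e = ∧-intro (Equivalence.from (entries⇔ T C⊆U) same)
                     (∧-intro (labelled-intro d γ T codims) (trans (Cond₁-↭ d T↭C) (∧-true₁ (∧-true₁ e))))
      where
      listing = Equivalence.to (lists⇔ (isIn C) T γ) (∧-true₂ {inLᵇ d C} e)
      uT = proj₁ listing
      codims = proj₂ (proj₂ listing)
      same : ∀ {Y} → Y ∈ toList T ⇔ Y ∈ C
      same = mk⇔ (Equivalence.to isIn⇔ ∘ Equivalence.to (proj₁ (proj₂ listing)))
                 (Equivalence.from (proj₁ (proj₂ listing)) ∘ Equivalence.from isIn⇔)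
      T↭C = same-members⇒↭ uT uC same

  labels : List ℕ
  labels = map suc (upTo d) ++ suc d ∷ []

  labels-unique : Unique labels
  labels-unique = Uniqueₚ.++⁺ (Uniqueₚ.map⁺ suc-injective (Uniqueₚ.upTo⁺ d)) (All.[] ∷ [])
    λ (p , q) → case q p
    where
    case : ∀ {k} → k ∈ suc d ∷ [] → k ∈ map suc (upTo d) → ⊥
    case (here refl) p = let k , k∈ , e = ∈-map⁻ suc p in <-irrefl (sym (suc-injective e)) (∈-upTo⁻ k∈)

  ∈labels : ∀ {k} → 1 ≤ k → k ≤ suc d → k ∈ labels
  ∈labels {suc k} _ k≤ with k ℕ.≟ d
  ... | yes refl = ∈-++⁺ʳ (map suc (upTo d)) (here refl)
  ... | no k≢d   = ∈-++⁺ˡ (∈-map⁺ suc (∈-upTo⁺ (≤∧≢⇒< (ℕ.s≤s⁻¹ k≤) k≢d)))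

  ∏mult!-labels : ∀ {l} (γ : Vec ℕ l) → ∏mult! labels (toList γ) ≡ prodMultFact d γ * (multiplicity (suc d) (toList γ) ! * 1)
  ∏mult!-labels γ = trans (cong product (Listₚ.map-++ _ (map suc (upTo d)) (suc d ∷ [])))
                          (product-++ (map (λ k → multiplicity k (toList γ) !) (map suc (upTo d))) _)

  codim-top : ∀ X → c X ≡ suc d → X ≡ Sub.⊥
  codim-top X e = ∣∣≡0⇒⊥ X (size ∣ X ∣ e)
    where
    size : ∀ k → suc d ∸ k ≡ suc d → k ≡ 0
    size zero    _ = refl
    size (suc k) e′ = ⊥-elim (<-irrefl refl (≤-trans (s≤s (≤-reflexive (sym e′))) (s≤s (m∸n≤m d k))))

  multiplicity-top : ∀ {C} → C ∈ sublists U → multiplicity (suc d) (map c C) ≤ 1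
  multiplicity-top {C} C⊆U = begin
    multiplicity (suc d) (map c C)
      ≡⟨ cong (λ Z → multiplicity (suc d) (map c Z)) (sublist-as-filter (allSubsets-unique n) C⊆U) ⟩
    multiplicity (suc d) (map c (filterᵇ (isIn C) U))
      ≡⟨ #label (isIn C) (suc d) U ⟨
    ∑[ X ← U ] 𝟙 (isIn C X ∧ (c X =ℕ suc d))
      ≤⟨ ∑-mono U (λ {X} _ → onlyEmpty X) ⟩
    ∑[ X ← U ] (𝟙 (Sub.⊥ ==ₛ X) * 𝟙 (isIn C X))
      ≡⟨ ∑-pickₛ S-enumerates (λ X → 𝟙 (isIn C X)) Sub.⊥ ⟩
    𝟙 (isIn C Sub.⊥)
      ≤⟨ 𝟙≤1 (isIn C Sub.⊥) ⟩
    1 ∎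
    where
    open ≤-Reasoning
    𝟙≤1 : ∀ b → 𝟙 b ≤ 1
    𝟙≤1 true  = ≤-refl
    𝟙≤1 false = z≤n
    onlyEmpty : ∀ X → 𝟙 (isIn C X ∧ (c X =ℕ suc d)) ≤ 𝟙 (Sub.⊥ ==ₛ X) * 𝟙 (isIn C X)
    onlyEmpty X with isIn C X | c X =ℕ suc d in e
    ... | false | _     = z≤n
    ... | true  | false = z≤n
    ... | true  | true  rewrite codim-top X (=ℕ-true e) | ==ₛ-refl Sub.⊥ = ≤-refl

  listings-of-collection : ∀ {l} (γ : Vec ℕ l) → 1 ≤ l → (∀ i → 1 ≤ lookup γ i) →
    (∀ i j → toℕ i ≤ toℕ j → lookup γ j ≤ lookup γ i) → ∀ {C} → C ∈ sublists U →
    𝟙 (inLᵇ d C) * #listings l (isIn C) γ ≡ 𝟙 (inLᵇ d C ∧ ⌊ typeOf d C ≡? toList γ ⌋) * prodMultFact d γ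
  listings-of-collection {l} γ l≥1 γ>0 mono {C} C⊆U with inLᵇ d C
  ... | false = refl
  ... | true with typeOf d C ≡? toList γ
  ...   | no ¬type = cong (_+ 0) (#listings-other l (isIn C) γ (¬type ∘ Equivalence.from type⇔ ∘ fromMembers))
    where
    type⇔ = typeOf⇔↭ d C γ l≥1 γ>0 mono
    fromMembers : map c (filterᵇ (isIn C) U) ↭ toList γ → map c C ↭ toList γ
    fromMembers = subst (λ Z → map c Z ↭ toList γ) (sym (sublist-as-filter (allSubsets-unique n) C⊆U))
  ...   | yes type = cong (_+ 0) (begin
    #listings l (isIn C) γ                                     ≡⟨ #listings-type labels-unique l (isIn C) γ q γ⊆labels ⟩
    ∏mult! labels (toList γ)                                   ≡⟨ ∏mult!-labels γ ⟩
    prodMultFact d γ * (multiplicity (suc d) (toList γ) ! * 1) ≡⟨ cong (λ x → prodMultFact d γ * (x * 1)) top! ⟩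
    prodMultFact d γ * 1                                       ≡⟨ *-identityʳ _ ⟩
    prodMultFact d γ                                           ∎)
    where
    open ≡-Reasoning
    codims↭γ : map c C ↭ toList γ
    codims↭γ = Equivalence.to (typeOf⇔↭ d C γ l≥1 γ>0 mono) type
    q : map c (filterᵇ (isIn C) U) ↭ toList γ
    q = subst (λ Z → map c Z ↭ toList γ) (sublist-as-filter (allSubsets-unique n) C⊆U) codims↭γ
    γ⊆labels : ∀ {k} → k ∈ toList γ → k ∈ labels
    γ⊆labels k∈ = ∈labels (let i , e = ∈-toList γ k∈ in subst (1 ≤_) e (γ>0 i))
                          (let X , _ , e = ∈-map⁻ c (↭ₚ.∈-resp-↭ (↭-sym codims↭γ) k∈) in
                           subst (_≤ suc d) (sym e) (m∸n≤m (suc d) ∣ X ∣))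
    -- the multiplicity of d+1 is at most 1, so its factorial is 1
    top! : multiplicity (suc d) (toList γ) ! ≡ 1
    top! = fact≤1 (subst (_≤ 1) (multiplicity-↭ (suc d) codims↭γ) (multiplicity-top C⊆U))
      where
      fact≤1 : ∀ {m} → m ≤ 1 → m ! ≡ 1
      fact≤1 {zero}  _ = refl
      fact≤1 {suc zero} _ = refl
      fact≤1 {suc (suc m)} (s≤s ())

  #tuples : ∀ {l} (γ : Vec ℕ l) → 1 ≤ l → (∀ i → 1 ≤ lookup γ i) →
            (∀ i j → toℕ i ≤ toℕ j → lookup γ j ≤ lookup γ i) →
            ∑[ T ← words U l ] 𝟙 (labelled d γ T ∧ Cond₁ d (toList T)) ≡ lam n d (toList γ) * prodMultFact d γ
  #tuples {l} γ l≥1 γ>0 mono = begin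
    ∑[ T ← words U l ] 𝟙 (labelled d γ T ∧ Cond₁ d (toList T))
      ≡⟨ ∑-by-entries l _ ⟩
    ∑[ C ← sublists U ] ∑[ T ← words U l ] (𝟙 (entries T Coll.== C) * 𝟙 (labelled d γ T ∧ Cond₁ d (toList T)))
      ≡⟨ ∑-cong (sublists U) (λ {C} C⊆U → ∑-cong (words U l) (λ {T} _ → perTuple T C⊆U)) ⟩
    ∑[ C ← sublists U ] ∑[ T ← words U l ] (𝟙 (inLᵇ d C) * 𝟙 (lists (isIn C) T γ))
      ≡⟨ ∑-cong (sublists U) (λ {C} _ → ∑-*ˡ (words U l) (𝟙 (inLᵇ d C)) _) ⟩
    ∑[ C ← sublists U ] (𝟙 (inLᵇ d C) * #listings l (isIn C) γ)
      ≡⟨ ∑-cong (sublists U) (listings-of-collection γ l≥1 γ>0 mono) ⟩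
    ∑[ C ← sublists U ] (𝟙 (inLᵇ d C ∧ ⌊ typeOf d C ≡? toList γ ⌋) * prodMultFact d γ)
      ≡⟨ ∑-*ʳ (sublists U) (prodMultFact d γ) _ ⟩
    ∑[ C ← sublists U ] 𝟙 (inLᵇ d C ∧ ⌊ typeOf d C ≡? toList γ ⌋) * prodMultFact d γ
      ≡⟨ cong (_* prodMultFact d γ) (length-filterᵇ _ (sublists U)) ⟨
    lam n d (toList γ) * prodMultFact d γ ∎
    where
    open ≡-Reasoning
    perTuple : ∀ T {C} → C ∈ sublists U →
               𝟙 (entries T Coll.== C) * 𝟙 (labelled d γ T ∧ Cond₁ d (toList T)) ≡ 𝟙 (inLᵇ d C) * 𝟙 (lists (isIn C) T γ)
    perTuple T {C} C⊆U = trans (sym (𝟙-∧ (entries T Coll.== C) _))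
                               (trans (cong 𝟙 (tuple⇔listing γ γ>0 T C⊆U)) (𝟙-∧ (inLᵇ d C) _))

-- The theorem: both sides count the words of length n over 2^{1..l} whose
-- profile lies in N(n,d;γ).
proposition4p7 : (n d l : ℕ) → 1 ≤ d → d < n → 1 ≤ l →
    (γ : Vec ℕ l) →
    ((i : Fin l) → 1 ≤ lookup γ i) →
    ((i : Fin l) → (j : Fin l) → toℕ i ≤ toℕ j → lookup γ j ≤ lookup γ i) →
    (lam n d (toList γ) * prodMultFact d γ ≡ sum (map (multinomialTerm n) (N n d γ)))
    × (lam n d (toList γ) * prodMultFact d γ ≡ sum (map (secondTerm n) (N n d γ)))
proposition4p7 n d l _ _ l≥1 γ γ>0 mono =
  sym (trans (∑N≡#words n d γ (multinomialTerm n) (multinomialTerm≡#words n)) wordsInN) ,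
  sym (trans (∑N≡#words n d γ (secondTerm n) (λ ν ∑ν≡n → trans (secondTerm≡multinomialTerm n ν ∑ν≡n)
                                                               (multinomialTerm≡#words n ν ∑ν≡n))) wordsInN)
  where
  open Profiles l
  open Conversion l
  wordsInN : ∑[ w ← words S n ] 𝟙 (inNᵇ n d γ (profile w)) ≡ lam n d (toList γ) * prodMultFact d γ
  wordsInN = begin
    ∑[ w ← words S n ] 𝟙 (inNᵇ n d γ (profile w))
      ≡⟨ ∑-cong (words S n) (λ {w} _ → cong 𝟙 (N⇔transpose n d γ w γ>0)) ⟩
    ∑[ w ← words S n ] 𝟙 (labelled d γ (transpose w) ∧ Cond₁ d (toList (transpose w)))
      ≡⟨ ∑-transpose l n (λ T → 𝟙 (labelled d γ T ∧ Cond₁ d (toList T))) ⟩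
    ∑[ T ← words (allSubsets n) l ] 𝟙 (labelled d γ T ∧ Cond₁ d (toList T))
      ≡⟨ Collections.#tuples n d γ l≥1 γ>0 mono ⟩
    lam n d (toList γ) * prodMultFact d γ ∎
    where open ≡-Reasoning
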